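{- Let $A\subseteq\mathrm{Ref}(n)$ be an antichain. Then in the partition lattice $\Pi_n$ we have $\textsc{fi}(A)^*=\textsc{fi}(B)$, where $$B=\min_{\mathrm{Ref}(n)}\Big(\mathfrak P_n\setminus \bigcup_{\lambda\in A}\mathrm{Dom}(n)_{\le\lambda'}\Big),$$ i.e. $B$ is the set of refinement-minimal number partitions of $n$ among those that are not dominated by $\lambda'$ for any $\lambda\in A$.
   Context: $\Pi_n$ is the lattice of set partitions of $[n]=\{1,\dots,n\}$ ordered by refinement ($\sigma\le\tau$ if every block of $\sigma$ is contained in a block of $\tau$); its bottom $\hat 0$ is the partition into singletons. $\mathfrak P_n$ is the set of partitions of the integer $n$, written with parts in decreasing order. For $\lambda=(\lambda_1,\lambda_2,\dots),\mu=(\mu_1,\mu_2,\dots)\in\mathfrak P_n$: in the dominance order $\mathrm{Dom}(n)$, $\lambda\le\mu$ if $\sum_{i\le k}\lambda_i\le\sum_{j\le k}\mu_j$ for all $k$; in the refinement order $\mathrm{Ref}(n)$, $\lambda\le\mu$ if $\lambda$ can be obtained from $\mu$ by partitioning its parts. $\mathrm{Dom}(n)_{\le x}=\{y: y\le x \text{ in }\mathrm{Dom}(n)\}$, $\lambda'$ is the transpose (conjugate) partition, and $\min_{\mathrm{Ref}(n)}E$ is the set of minimal elements of $E$ in $\mathrm{Ref}(n)$. The shape map $\textsc{sh}:\Pi_n\to\mathfrak P_n$ sends a set partition to the multiset of its block sizes, and $\textsc{fi}(S)=\textsc{sh}^{ -1}(S)$ for $S\subseteq\mathfrak P_n$. In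 a finite bounded poset $P$ (bottom $\hat 0$, top $\hat1$), an antichain is a nonempty set $A$ with $\hat 0\notin A$ of pairwise incomparable elements; $\Lambda(x)$ denotes the set of atoms below $x$; the blocker of an antichain $A$ is $A^*=\min\{x\in P:\Lambda(x)\cap\Lambda(a)\neq\emptyset\ \forall a\in A\}$ ($\min$ = set of minimal elements). In particular an antichain in $\mathrm{Ref}(n)$ does not contain its bottom element $(1^n)$. -}

module Defs where

open import Data.Bool using (Bool; true; false; T; not; _∧_)
open import Data.Nat using (ℕ; zero; suc; _≤_; _<_; _<ᵇ_; _≤ᵇ_)
open import Data.Fin using (Fin; toℕ)
open import Data.Fin.Properties using () renaming (_≟_ to _≟ᶠ_)
open import Data.List using (List; []; _∷_; take; map; length; filterᵇ; upTo; allFin; replicate; concat)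
open import Data.Nat.ListAction using (sum)
open import Data.Bool.ListAction using (any)
open import Data.List.Membership.Propositional using (_∈_; _∉_)
open import Data.List.Relation.Unary.All using (All)
open import Data.List.Relation.Unary.Linked using (Linked)
open import Data.List.Relation.Binary.Pointwise using (Pointwise)
open import Data.List.Relation.Binary.Permutation.Propositional using (_↭_)
open import Data.Product using (Σ; ∃; _×_; _,_)
open import Data.Sum using (_⊎_)
open import Relation.Nullary using (¬_; Dec; yes; no)
open import Relation.Nullary.Decidable using (⌊_⌋)
open import Relation.Binary.PropositionalEquality using (_≡_; refl; sym; trans)

IsPart : ℕ → List ℕ → Set
IsPart n μ = Linked (λ a b → b ≤ a) μ × All (λ a → 0 < a) μ × sum μ ≡ n

_≤Dom_ : List ℕ → List ℕ → Set
μ ≤Dom ν = ∀ k → sum (take k μ) ≤ sum (take k ν)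

_≤Ref_ : List ℕ → List ℕ → Set
μ ≤Ref ν = Σ (List (List ℕ)) λ ls →
  Pointwise (λ p l → sum l ≡ p) ν ls × All (All (λ a → 0 < a)) ls × concat ls ↭ μ

-- Transpose (conjugate) partition: λ'_i = #{ j : λ_j ≥ i }, i = 1..λ_1.
conj : List ℕ → List ℕ
conj [] = []
conj (x ∷ xs) = map (λ i → length (filterᵇ (λ y → i <ᵇ y) (x ∷ xs))) (upTo x)

IsAntichainRef : ℕ → List (List ℕ) → Set
IsAntichainRef n A =
  (Σ (List ℕ) λ μ → μ ∈ A) ×
  replicate n 1 ∉ A ×
  All (IsPart n) A ×
  (∀ μ ν → μ ∈ A → ν ∈ A → μ ≤Ref ν → μ ≡ ν)

NotDominated : List (List ℕ) → List ℕ → Set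
NotDominated A μ = ∀ λ₀ → λ₀ ∈ A → ¬ (μ ≤Dom conj λ₀)

InB : ℕ → List (List ℕ) → List ℕ → Set
InB n A μ = IsPart n μ × NotDominated A μ ×
  (∀ ν → IsPart n ν → NotDominated A ν → ν ≤Ref μ → ν ≡ μ)

record SetPart (n : ℕ) : Set where
  field
    rel   : Fin n → Fin n → Bool
    reflR : ∀ i → rel i i ≡ true
    symR  : ∀ i j → rel i j ≡ true → rel j i ≡ true
    transR : ∀ i j k → rel i j ≡ true → rel j k ≡ true → rel i k ≡ true
open SetPart public

_≤Π_ : ∀ {n} → SetPart n → SetPart n → Set
σ ≤Π τ = ∀ i j → rel σ i j ≡ true → rel τ i j ≡ true

private
  eqb : ∀ {n} → Fin n → Fin n → Bool
  eqb i j = ⌊ i ≟ᶠ j ⌋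

  eqb-refl : ∀ {n} (i : Fin n) → eqb i i ≡ true
  eqb-refl i with i ≟ᶠ i
  ... | yes _ = refl
  ... | no ¬p = Data.Empty.⊥-elim (¬p refl)
    where import Data.Empty

  eqb-sound : ∀ {n} (i j : Fin n) → eqb i j ≡ true → i ≡ j
  eqb-sound i j e with i ≟ᶠ j
  ... | yes p = p
  eqb-sound i j () | no _

  eqb-complete : ∀ {n} (i j : Fin n) → i ≡ j → eqb i j ≡ true
  eqb-complete i .i refl = eqb-refl i

bottomΠ : ∀ n → SetPart n
bottomΠ n = record
  { rel = eqb
  ; reflR = eqb-refl
  ; symR = λ i j e → eqb-complete j i (sym (eqb-sound i j e))
  ; transR = λ i j k e f → eqb-complete i k (trans (eqb-sound i j e) (eqb-sound j k f))
  }

blockSize : ∀ {n} → SetPart n → Fin n → ℕ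
blockSize {n} σ i = length (filterᵇ (rel σ i) (allFin n))

isLeast : ∀ {n} → SetPart n → Fin n → Bool
isLeast {n} σ i = not (any (λ j → (toℕ j <ᵇ toℕ i) ∧ rel σ j i) (allFin n))

blockSizes : ∀ {n} → SetPart n → List ℕ
blockSizes {n} σ = map (blockSize σ) (filterᵇ (isLeast σ) (allFin n))

HasShape : ∀ {n} → SetPart n → List ℕ → Set
HasShape σ μ = blockSizes σ ↭ μ

Fi : ∀ n → (List ℕ → Set) → SetPart n → Set
Fi n S σ = Σ (List ℕ) λ μ → S μ × HasShape σ μ

module PosetNotions {P : Set} (_≤_ : P → P → Set) (bot : P) where
  _≈_ : P → P → Set
  x ≈ y = (x ≤ y) × (y ≤ x)

  Atom : P → Set
  Atom a = ¬ (a ≈ bot) × (∀ x → x ≤ a → (x ≈ bot) ⊎ (x ≈ a))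

  AtomsMeet : P → P → Set
  AtomsMeet x y = Σ P λ t → Atom t × t ≤ x × t ≤ y

  Hits : (P → Set) → P → Set
  Hits A x = ∀ a → A a → AtomsMeet x a

  InBlocker : (P → Set) → P → Set
  InBlocker A x = Hits A x × (∀ y → Hits A y → y ≤ x → x ≤ y)

InBlockerΠ : ∀ n → (SetPart n → Set) → SetPart n → Set
InBlockerΠ n = PosetNotions.InBlocker (_≤Π_ {n}) (bottomΠ n)

{-# OPTIONS --safe #-}
-- Say σ ∧ τ = 0̂ when σ and τ have no pair i ≠ j in a common block.  The atoms of Π_n are the
-- partitions joining a single pair, so Λ(σ) ∩ Λ(τ) = ∅ exactly when σ ∧ τ = 0̂.  The heart of the
-- proof is a Gale–Ryser statement: some τ of shape λ has σ ∧ τ = 0̂ iff sh(σ) ≤Dom λ'.  If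
-- σ ∧ τ = 0̂, a block b of τ meets the k largest blocks of σ in at most min(|b|, k) points, and
-- Σ_b min(|b|, k) is the k-th partial sum of λ'.  Conversely τ is built greedily: the blocks of
-- σ, largest first, are dealt out one element to each of the blocks of τ with the most room
-- left, and dominance guarantees that there is always enough room.  So σ meets every member of
-- fi(A) iff sh(σ) is dominated by no λ' with λ ∈ A.  Minimality then passes between Π_n and
-- Ref(n): refining σ refines its shape, every refinement of sh(σ) is the shape of a refinement
-- of σ, and a refinement of σ with the same shape is σ itself.

module Submission where

open import Defs

open import Data.Bool using (Bool; true; false; T; not; _∧_; if_then_else_)
open import Data.Bool.ListAction using (any; or)
open import Data.Bool.Properties using (T-≡; T-∧; ¬-not)
import Data.Bool.Properties as Bool
open import Data.Empty using (⊥)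
open import Data.Fin using (Fin; toℕ) renaming (_<_ to _<ᶠ_)
open import Data.Fin.Induction using () renaming (<-wellFounded to <-wellFounded-Fin)
import Data.Fin.Properties as Fin
open import Data.List
  using (List; []; _∷_; _++_; map; length; filterᵇ; take; drop; concat; concatMap; allFin; upTo; applyUpTo; [_])
open import Data.List.Properties
  using ( length-++; length-take; length-drop; length-tabulate; map-id; map-∘; map-cong; map-cong-local; map-++
        ; map-upTo; take-map; concat-map; concat-++; take++drop≡id; ++-assoc; ++-identityʳ
        ; filter-++; filter-all; filter-none; filter-some; filter-≐ )
open import Data.List.Membership.Propositional using (_∈_)
open import Data.List.Membership.Propositional.Properties
  using (∈-map⁻; ∈-concat⁺′; ∈-filter⁻; ∈-filter⁺; ∈-∃++; ∈-++⁺ˡ; ∈-++⁺ʳ; ∈-++⁻; ∈-allFin)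
open import Data.List.Relation.Binary.Permutation.Propositional
  using (_↭_; ↭-refl; ↭-reflexive; ↭-sym; ↭-trans; ↭-prep; ↭-swap; ↭⇒↭ₛ′)
import Data.List.Relation.Binary.Permutation.Propositional as ↭
open import Data.List.Relation.Binary.Permutation.Propositional.Properties
  using (filter-↭; ↭-length; ++⁺ˡ; ++⁺ʳ; shift; shifts; map⁺; ∈-resp-↭; All-resp-↭)
import Data.List.Relation.Binary.Permutation.Setoid.Properties as PermSetoid
open import Data.List.Relation.Binary.Pointwise using (Pointwise; []; _∷_; Pointwise-≡⇒≡)
open import Data.List.Relation.Unary.All as All using (All; []; _∷_)
open import Data.List.Relation.Unary.All.Properties
  using () renaming (map⁺ to All-map⁺; map⁻ to All-map⁻; concat⁺ to All-concat⁺)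
open import Data.List.Relation.Unary.Any as Any using (here; there; satisfied)
open import Data.List.Relation.Unary.Any.Properties using (any⁺; any⁻)
open import Data.List.Relation.Unary.Linked as Linked using (Linked; []; _∷_)
open import Data.List.Relation.Unary.Linked.Properties using (Linked⇒All) renaming (map⁺ to Linked-map⁺)
open import Data.List.Relation.Unary.Sorted.TotalOrder.Properties using (↗↭↗⇒≋)
open import Data.List.Relation.Unary.Unique.Propositional using (Unique; []; _∷_)
import Data.List.Relation.Unary.Unique.Propositional.Properties as Unique
open import Data.Nat using (ℕ; zero; suc; _+_; _*_; _∸_; _≤_; _<_; _≥_; _⊓_; z≤n; s≤s; _<ᵇ_; _≡ᵇ_; pred)
open import Data.Nat.ListAction using (sum)
open import Data.Nat.ListAction.Properties using (sum-++; sum-↭)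
open import Data.Nat.Properties
open import Algebra.Properties.CommutativeSemigroup +-commutativeSemigroup
  using (x∙yz≈y∙xz) renaming (interchange to +-interchange)
open import Data.Product using (∃-syntax; _×_; _,_; proj₁; proj₂)
open import Data.Sum using (_⊎_; inj₁; inj₂)
open import Function using (id; _∘_; case_of_; _⇔_; Equivalence; mk⇔)
import Induction.WellFounded as WF
open import Relation.Binary.Definitions using (DecidableEquality; tri<; tri≈; tri>)
import Relation.Binary.Construct.Flip.EqAndOrd as Flip
import Relation.Binary.Construct.On as On
open import Relation.Binary.PropositionalEquality
  using (_≡_; _≢_; refl; sym; trans; cong; cong₂; subst; setoid; isEquivalence; module ≡-Reasoning)
open import Relation.Nullary using (¬_; Dec; yes; no; contradiction)
open import Relation.Nullary.Decidable
  using (does; T?; dec-true; dec-false; does-⇔; ¬?; _×-dec_; _⊎-dec_)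

open Equivalence using (to; from)

≡true⇒T : ∀ {b} → b ≡ true → T b
≡true⇒T = from T-≡

T⇒≡true : ∀ {b} → T b → b ≡ true
T⇒≡true = to T-≡

Bool-ext : ∀ {a b} → (a ≡ true → b ≡ true) → (b ≡ true → a ≡ true) → a ≡ b
Bool-ext f g = does-⇔ (mk⇔ (≡true⇒T ∘ f ∘ T⇒≡true) (≡true⇒T ∘ g ∘ T⇒≡true)) (T? _) (T? _)

Unique-resp-↭ : ∀ {A : Set} {xs ys : List A} → xs ↭ ys → Unique xs → Unique ys
Unique-resp-↭ {A} p = PermSetoid.Unique-resp-↭ (setoid A) (↭⇒↭ₛ′ isEquivalence p)

Unique-++⁻ : ∀ {A : Set} (xs : List A) {ys} → Unique (xs ++ ys) → Unique ys × (∀ {x} → x ∈ xs → x ∈ ys → ⊥)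
Unique-++⁻ [] u = u , λ ()
Unique-++⁻ (x ∷ xs) (x∉ ∷ u) = proj₁ (Unique-++⁻ xs u) , λ
  { (here refl) x∈ys → All.lookup x∉ (∈-++⁺ʳ xs x∈ys) refl
  ; (there y∈xs) y∈ys → proj₂ (Unique-++⁻ xs u) y∈xs y∈ys }

∈-take⁻ : ∀ {A : Set} {x : A} k xs → x ∈ take k xs → x ∈ xs
∈-take⁻ (suc k) (y ∷ xs) (here x≡y) = here x≡y
∈-take⁻ (suc k) (y ∷ xs) (there x∈) = there (∈-take⁻ k xs x∈)

∈-drop⁻ : ∀ {A : Set} {x : A} k xs → x ∈ drop k xs → x ∈ xs
∈-drop⁻ zero xs x∈ = x∈
∈-drop⁻ (suc k) (y ∷ xs) x∈ = there (∈-drop⁻ k xs x∈)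

∑ : {A : Set} → (A → ℕ) → List A → ℕ
∑ f xs = sum (map f xs)

module _ {A : Set} where

  count : (A → Bool) → List A → ℕ
  count p xs = length (filterᵇ p xs)

  count-++ : ∀ p (xs ys : List A) → count p (xs ++ ys) ≡ count p xs + count p ys
  count-++ p xs ys = trans (cong length (filter-++ (T? ∘ p) xs ys)) (length-++ (filterᵇ p xs))

  count-↭ : ∀ p {xs ys : List A} → xs ↭ ys → count p xs ≡ count p ys
  count-↭ p r = ↭-length (filter-↭ _ r)

  count-concat : ∀ p (xss : List (List A)) → count p (concat xss) ≡ ∑ (count p) xss
  count-concat p [] = refl
  count-concat p (xs ∷ xss) = trans (count-++ p xs (concat xss)) (cong (count p xs +_) (count-concat p xss))

  count-all : ∀ p (xs : List A) → (∀ {x} → x ∈ xs → p x ≡ true) → count p xs ≡ length xs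
  count-all p xs h = cong length (filter-all (T? ∘ p) (All.tabulate (≡true⇒T ∘ h)))

  count-none : ∀ p (xs : List A) → (∀ {x} → x ∈ xs → p x ≡ false) → count p xs ≡ 0
  count-none p xs h = cong length (filter-none (T? ∘ p) (All.tabulate λ m → subst T (h m)))

  count>0 : ∀ p {x} (xs : List A) → x ∈ xs → p x ≡ true → 0 < count p xs
  count>0 p xs m px = filter-some (T? ∘ p) (Any.map (λ { refl → ≡true⇒T px }) m)

  count>0⁻ : ∀ p (xs : List A) → 0 < count p xs → ∃[ x ] x ∈ xs × p x ≡ true
  count>0⁻ p xs pos with filterᵇ p xs in eq
  ... | y ∷ _ = let y∈xs , py = ∈-filter⁻ (T? ∘ p) (subst (y ∈_) (sym eq) (here refl)) in y , y∈xs , T⇒≡true py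

  count-cong : ∀ {p q} (xs : List A) → (∀ {x} → x ∈ xs → p x ≡ q x) → count p xs ≡ count q xs
  count-cong [] h = refl
  count-cong {p} {q} (x ∷ xs) h with p x | q x | h (here refl)
  ... | true  | true  | _ = cong suc (count-cong xs (h ∘ there))
  ... | false | false | _ = count-cong xs (h ∘ there)

  count-mono : ∀ {p q} (xs : List A) → (∀ {x} → x ∈ xs → p x ≡ true → q x ≡ true) → count p xs ≤ count q xs
  count-mono [] h = z≤n
  count-mono {p} {q} (x ∷ xs) h with p x in px | q x in qx
  ... | true  | true  = s≤s (count-mono xs (h ∘ there))
  ... | true  | false = contradiction (trans (sym (h (here refl) px)) qx) λ ()
  ... | false | true  = m≤n⇒m≤1+n (count-mono xs (h ∘ there))
  ... | false | false = count-mono xs (h ∘ there)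

  count-mono-≡ : ∀ {p q} (xs : List A) → (∀ {x} → x ∈ xs → p x ≡ true → q x ≡ true) →
                 count p xs ≡ count q xs → ∀ {x} → x ∈ xs → q x ≡ true → p x ≡ true
  count-mono-≡ {p} {q} (y ∷ xs) h eq x∈ qx with p y in py | q y in qy | x∈
  ... | true  | false | _ = contradiction (trans (sym (h (here refl) py)) qy) λ ()
  ... | false | true  | _ = contradiction eq (<⇒≢ (s≤s (count-mono xs (h ∘ there))))
  ... | true  | true  | here refl = py
  ... | false | false | here refl = contradiction (trans (sym qx) qy) λ ()
  ... | true  | true  | there x∈xs = count-mono-≡ xs (h ∘ there) (suc-injective eq) x∈xs qx
  ... | false | false | there x∈xs = count-mono-≡ xs (h ∘ there) eq x∈xs qx

  count≤1 : ∀ p {xs : List A} → Unique xs →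
            (∀ {x y} → x ∈ xs → y ∈ xs → p x ≡ true → p y ≡ true → x ≡ y) → count p xs ≤ 1
  count≤1 p {[]} [] h = z≤n
  count≤1 p {x ∷ xs} (x∉xs ∷ u) h with p x in px
  ... | true  = s≤s (≤-reflexive (count-none p xs λ y∈xs →
                  ¬-not λ py → All.lookup x∉xs y∈xs (h (here refl) (there y∈xs) px py)))
  ... | false = count≤1 p u λ x∈ y∈ → h (there x∈) (there y∈)

  count≡1 : ∀ p {xs : List A} {x} → Unique xs → x ∈ xs → p x ≡ true →
            (∀ {y} → y ∈ xs → p y ≡ true → y ≡ x) → count p xs ≡ 1
  count≡1 p u x∈ px h = ≤-antisym (count≤1 p u λ y∈ z∈ py pz → trans (h y∈ py) (sym (h z∈ pz)))
                                  (count>0 p _ x∈ px)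

  count-accept : ∀ p {x} (xs : List A) → p x ≡ true → count p (x ∷ xs) ≡ suc (count p xs)
  count-accept p {x} xs px rewrite px = refl

  count-reject : ∀ p {x} (xs : List A) → p x ≡ false → count p (x ∷ xs) ≡ count p xs
  count-reject p {x} xs px rewrite px = refl

  count-∷-cancel : ∀ p {x} (xs ys : List A) → count p (x ∷ xs) ≡ count p (x ∷ ys) → count p xs ≡ count p ys
  count-∷-cancel p {x} xs ys eq with p x
  ... | true  = suc-injective eq
  ... | false = eq

count-map : ∀ {A B : Set} (p : B → Bool) (f : A → B) xs → count p (map f xs) ≡ count (p ∘ f) xs
count-map p f [] = refl
count-map p f (x ∷ xs) with p (f x)
... | true  = cong suc (count-map p f xs)
... | false = count-map p f xs

count-filter-⊆ : ∀ {A : Set} (p q : A → Bool) xs → (∀ {x} → x ∈ xs → q x ≡ true → p x ≡ true) →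
                 count q (filterᵇ p xs) ≡ count q xs
count-filter-⊆ p q [] h = refl
count-filter-⊆ p q (x ∷ xs) h with p x in px
... | true with q x
...   | true  = cong suc (count-filter-⊆ p q xs (h ∘ there))
...   | false = count-filter-⊆ p q xs (h ∘ there)
count-filter-⊆ p q (x ∷ xs) h | false =
  trans (count-filter-⊆ p q xs (h ∘ there))
        (sym (count-reject q xs (¬-not λ qx → case trans (sym (h (here refl) qx)) px of λ ())))

count-concat-take≤ : ∀ {A : Set} p k (Es : List (List A)) → count p (concat (take k Es)) ≤ count p (concat Es)
count-concat-take≤ p k Es = begin
  count p (concat (take k Es))                                ≤⟨ m≤m+n _ _ ⟩
  count p (concat (take k Es)) + count p (concat (drop k Es)) ≡⟨ count-++ p (concat (take k Es)) _ ⟨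
  count p (concat (take k Es) ++ concat (drop k Es))          ≡⟨ cong (count p) (concat-++ (take k Es) (drop k Es)) ⟩
  count p (concat (take k Es ++ drop k Es))                   ≡⟨ cong (count p ∘ concat) (take++drop≡id k Es) ⟩
  count p (concat Es)                                         ∎
  where open ≤-Reasoning

module _ {A : Set} where

  ∑-cong : ∀ {f g} (xs : List A) → (∀ {x} → x ∈ xs → f x ≡ g x) → ∑ f xs ≡ ∑ g xs
  ∑-cong [] h = refl
  ∑-cong (x ∷ xs) h = cong₂ _+_ (h (here refl)) (∑-cong xs (h ∘ there))

  ∑-mono : ∀ {f g} (xs : List A) → (∀ {x} → x ∈ xs → f x ≤ g x) → ∑ f xs ≤ ∑ g xs
  ∑-mono [] h = z≤n
  ∑-mono (x ∷ xs) h = +-mono-≤ (h (here refl)) (∑-mono xs (h ∘ there))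

  ∑-mono-≡ : ∀ {f g} (xs : List A) → (∀ {x} → x ∈ xs → f x ≤ g x) → ∑ f xs ≡ ∑ g xs →
             ∀ {x} → x ∈ xs → f x ≡ g x
  ∑-mono-≡ {f} {g} (y ∷ xs) h eq y∈ with m≤n⇒m<n∨m≡n (h (here refl)) | y∈
  ... | inj₁ fy<gy | _ = contradiction eq (<⇒≢ (+-mono-<-≤ fy<gy (∑-mono xs (h ∘ there))))
  ... | inj₂ fy≡gy | here refl = fy≡gy
  ... | inj₂ fy≡gy | there x∈xs =
    ∑-mono-≡ xs (h ∘ there) (+-cancelˡ-≡ (f y) _ _ (trans eq (cong (_+ ∑ g xs) (sym fy≡gy)))) x∈xs

  ∑-+ : ∀ f g (xs : List A) → ∑ (λ x → f x + g x) xs ≡ ∑ f xs + ∑ g xs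
  ∑-+ f g [] = refl
  ∑-+ f g (x ∷ xs) = trans (cong (f x + g x +_) (∑-+ f g xs)) (+-interchange (f x) (g x) (∑ f xs) (∑ g xs))

  ∑-↭ : ∀ f {xs ys : List A} → xs ↭ ys → ∑ f xs ≡ ∑ f ys
  ∑-↭ f r = sum-↭ (map⁺ f r)

  ∑-concat : ∀ f (xss : List (List A)) → ∑ f (concat xss) ≡ ∑ (∑ f) xss
  ∑-concat f [] = refl
  ∑-concat f (xs ∷ xss) =
    trans (cong sum (map-++ f xs (concat xss)))
          (trans (sum-++ (map f xs) (map f (concat xss))) (cong (∑ f xs +_) (∑-concat f xss)))

  ∑-const : ∀ c (xs : List A) → ∑ (λ _ → c) xs ≡ length xs * c
  ∑-const c [] = refl
  ∑-const c (x ∷ xs) = cong (c +_) (∑-const c xs)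

  ∑≡0 : ∀ {f} (xs : List A) → ∑ f xs ≡ 0 → ∀ {x} → x ∈ xs → f x ≡ 0
  ∑≡0 {f} (x ∷ xs) eq (here refl) = m+n≡0⇒m≡0 (f x) eq
  ∑≡0 {f} (x ∷ xs) eq (there x∈) = ∑≡0 xs (m+n≡0⇒n≡0 (f x) eq) x∈

  length-concat : ∀ (xss : List (List A)) → length (concat xss) ≡ ∑ length xss
  length-concat [] = refl
  length-concat (xs ∷ xss) = trans (length-++ xs) (cong (length xs +_) (length-concat xss))

∑-count-swap : ∀ {A B : Set} (R : A → B → Bool) (is : List A) (ys : List B) →
               ∑ (λ i → count (R i) ys) is ≡ ∑ (λ y → count (λ i → R i y) is) ys
∑-count-swap R is [] = trans (∑-const 0 is) (*-zeroʳ (length is))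
∑-count-swap R is (y ∷ ys) = begin
  ∑ (λ i → count (R i) (y ∷ ys)) is
    ≡⟨ ∑-cong is (λ {i} _ → count-++ (R i) [ y ] ys) ⟩
  ∑ (λ i → count (R i) [ y ] + count (R i) ys) is
    ≡⟨ ∑-+ (λ i → count (R i) [ y ]) (λ i → count (R i) ys) is ⟩
  ∑ (λ i → count (R i) [ y ]) is + ∑ (λ i → count (R i) ys) is
    ≡⟨ cong₂ _+_ (single is) (∑-count-swap R is ys) ⟩
  count (λ i → R i y) is + ∑ (λ y → count (λ i → R i y) is) ys ∎
  where
  open ≡-Reasoning
  single : ∀ is → ∑ (λ i → count (R i) [ y ]) is ≡ count (λ i → R i y) is
  single [] = refl
  single (i ∷ is) with R i y
  ... | true  = cong suc (single is)
  ... | false = single is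

module _ {J X : Set} (p : J → X → Bool) where

  private
    pieces : List J → List X → List X
    pieces js xs = concatMap (λ j → filterᵇ (p j) xs) js

    pieces-[] : ∀ js → pieces js [] ≡ []
    pieces-[] [] = refl
    pieces-[] (j ∷ js) = pieces-[] js

    pieces-skip : ∀ js {x xs} → count (λ j → p j x) js ≡ 0 → pieces js (x ∷ xs) ≡ pieces js xs
    pieces-skip [] c = refl
    pieces-skip (j ∷ js) {x} {xs} c with p j x
    ... | true  = contradiction c λ ()
    ... | false = cong (filterᵇ (p j) xs ++_) (pieces-skip js c)

    pieces-insert : ∀ js {x xs} → count (λ j → p j x) js ≡ 1 → pieces js (x ∷ xs) ↭ x ∷ pieces js xs
    pieces-insert (j ∷ js) {x} {xs} c with p j x
    ... | true  = ↭-prep x (↭-reflexive (cong (filterᵇ (p j) xs ++_) (pieces-skip js (suc-injective c))))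
    ... | false = ↭-trans (++⁺ˡ (filterᵇ (p j) xs) (pieces-insert js c))
                          (shift x (filterᵇ (p j) xs) (pieces js xs))

  concatMap-filter-↭ : ∀ js xs → (∀ {x} → x ∈ xs → count (λ j → p j x) js ≡ 1) →
                       concatMap (λ j → filterᵇ (p j) xs) js ↭ xs
  concatMap-filter-↭ js [] h = ↭-reflexive (pieces-[] js)
  concatMap-filter-↭ js (x ∷ xs) h =
    ↭-trans (pieces-insert js (h (here refl))) (↭-prep x (concatMap-filter-↭ js xs (h ∘ there)))

concat⁺ : ∀ {A : Set} {xss yss : List (List A)} → xss ↭ yss → concat xss ↭ concat yss
concat⁺ ↭.refl = ↭-refl
concat⁺ (↭.prep xs r) = ++⁺ˡ xs (concat⁺ r)
concat⁺ (↭.swap xs ys r) = ↭-trans (shifts xs ys) (++⁺ˡ ys (++⁺ˡ xs (concat⁺ r)))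
concat⁺ (↭.trans r s) = ↭-trans (concat⁺ r) (concat⁺ s)

Pointwise-map : ∀ {A B C : Set} {R : B → C → Set} (f : A → B) (g : A → C) xs →
                (∀ {x} → x ∈ xs → R (f x) (g x)) → Pointwise R (map f xs) (map g xs)
Pointwise-map f g [] h = []
Pointwise-map f g (x ∷ xs) h = h (here refl) ∷ Pointwise-map f g xs (h ∘ there)

Pointwise-↭ : ∀ {A B : Set} {R : A → B → Set} {as bs : List A} {ls : List B} →
              Pointwise R as ls → as ↭ bs → ∃[ ls′ ] Pointwise R bs ls′ × ls ↭ ls′
Pointwise-↭ rs ↭.refl = _ , rs , ↭-refl
Pointwise-↭ (r ∷ rs) (↭.prep x p) = let ls′ , rs′ , q = Pointwise-↭ rs p in _ ∷ ls′ , r ∷ rs′ , ↭-prep _ q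
Pointwise-↭ (r ∷ r′ ∷ rs) (↭.swap x y p) =
  let ls′ , rs′ , q = Pointwise-↭ rs p in _ ∷ _ ∷ ls′ , r′ ∷ r ∷ rs′ , ↭-swap _ _ q
Pointwise-↭ rs (↭.trans p p′) =
  let ls₁ , rs₁ , q₁ = Pointwise-↭ rs p ; ls₂ , rs₂ , q₂ = Pointwise-↭ rs₁ p′ in ls₂ , rs₂ , ↭-trans q₁ q₂

-- Multisets of block sizes

module _ {A : Set} (_≟_ : DecidableEquality A) where

  multiplicity : A → List A → ℕ
  multiplicity v = count (λ x → does (x ≟ v))

  ↭-from-multiplicities : ∀ (xs ys : List A) → (∀ v → multiplicity v xs ≡ multiplicity v ys) → xs ↭ ys
  ↭-from-multiplicities [] [] h = ↭-refl
  ↭-from-multiplicities [] (y ∷ ys) h =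
    contradiction (h y) (<⇒≢ (count>0 (λ z → does (z ≟ y)) (y ∷ ys) (here refl) (dec-true (y ≟ y) refl)))
  ↭-from-multiplicities (x ∷ xs) ys h
    with count>0⁻ (λ z → does (z ≟ x)) ys
                  (subst (0 <_) (h x) (count>0 (λ z → does (z ≟ x)) (x ∷ xs) (here refl) (dec-true (x ≟ x) refl)))
  ... | y , y∈ys , y≡ᵈx with y ≟ x | y≡ᵈx
  ...   | no _     | ()
  ...   | yes refl | _ with ∈-∃++ y∈ys
  ...     | as , bs , refl =
    ↭-trans (↭-prep x (↭-from-multiplicities xs (as ++ bs) rest)) (↭-sym (shift x as bs))
    where
    rest : ∀ v → multiplicity v xs ≡ multiplicity v (as ++ bs)
    rest v = count-∷-cancel (λ z → does (z ≟ v)) xs (as ++ bs)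
               (trans (h v) (count-↭ (λ z → does (z ≟ v)) (shift x as bs)))

module _ {A : Set} (size : A → ℕ) where

  SizedBy : List (List A) → Set
  SizedBy Bs = ∀ {B x} → B ∈ Bs → x ∈ B → size x ≡ length B

  private
    hasSize : ℕ → A → Bool
    hasSize v x = does (size x ≟ v)

    count-hasSize : ∀ Bs → SizedBy Bs → ∀ v →
                    count (hasSize v) (concat Bs) ≡ v * multiplicity _≟_ v (map length Bs)
    count-hasSize [] sized v = sym (*-zeroʳ v)
    count-hasSize (B ∷ Bs) sized v = begin
      count (hasSize v) (B ++ concat Bs)
        ≡⟨ count-++ (hasSize v) B (concat Bs) ⟩
      count (hasSize v) B + count (hasSize v) (concat Bs)
        ≡⟨ cong₂ _+_ (count-cong B (cong isV ∘ sized (here refl)))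
                     (count-hasSize Bs (sized ∘ there) v) ⟩
      count (λ _ → isV (length B)) B + v * rest
        ≡⟨ head-block ⟩
      v * multiplicity _≟_ v (map length (B ∷ Bs)) ∎
      where
      open ≡-Reasoning
      isV : ℕ → Bool
      isV x = does (x ≟ v)
      rest : ℕ
      rest = count isV (map length Bs)

      head-block : count (λ _ → isV (length B)) B + v * rest ≡ v * count isV (length B ∷ map length Bs)
      head-block with length B ≟ v
      ... | yes refl = begin
        count (λ _ → isV v) B + v * rest  ≡⟨ cong (_+ v * rest) (count-all (λ _ → isV v) B λ _ → isV-v) ⟩
        v + v * rest                      ≡⟨ *-suc v rest ⟨
        v * suc rest                      ≡⟨ cong (v *_) (count-accept isV {v} (map length Bs) isV-v) ⟨
        v * count isV (v ∷ map length Bs) ∎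
        where
        isV-v : isV v ≡ true
        isV-v = dec-true (v ≟ v) refl
      ... | no B≢v = cong₂ _+_ (count-none (λ _ → isV (length B)) B λ _ → ¬isV-B)
                               (cong (v *_) (sym (count-reject isV {length B} (map length Bs) ¬isV-B)))
        where
        ¬isV-B : isV (length B) ≡ false
        ¬isV-B = dec-false (length B ≟ v) B≢v

    multiplicity-0 : ∀ {Bs : List (List A)} → All (λ B → 0 < length B) Bs →
                     multiplicity _≟_ 0 (map length Bs) ≡ 0
    multiplicity-0 nonEmpty = count-none (λ x → does (x ≟ 0)) _
      λ {x} x∈ → dec-false (x ≟ 0) (>⇒≢ (All.lookup (All-map⁺ {f = length} nonEmpty) x∈))

  -- For v > 0 both sides count the elements of size v as v times the number of blocks of length v.
  lengths-↭ : ∀ {Bs Cs : List (List A)} → concat Bs ↭ concat Cs →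
              All (λ B → 0 < length B) Bs → All (λ C → 0 < length C) Cs →
              SizedBy Bs → SizedBy Cs → map length Bs ↭ map length Cs
  lengths-↭ {Bs} {Cs} Bs↭Cs neBs neCs sizedBs sizedCs = ↭-from-multiplicities _≟_ _ _ sameMultiplicity
    where
    sameMultiplicity : ∀ v → multiplicity _≟_ v (map length Bs) ≡ multiplicity _≟_ v (map length Cs)
    sameMultiplicity zero = trans (multiplicity-0 neBs) (sym (multiplicity-0 neCs))
    sameMultiplicity (suc v) = *-cancelˡ-≡ _ _ (suc v) (begin
      suc v * multiplicity _≟_ (suc v) (map length Bs) ≡⟨ count-hasSize Bs sizedBs (suc v) ⟨
      count (hasSize (suc v)) (concat Bs)                ≡⟨ count-↭ (hasSize (suc v)) Bs↭Cs ⟩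
      count (hasSize (suc v)) (concat Cs)                ≡⟨ count-hasSize Cs sizedCs (suc v) ⟩
      suc v * multiplicity _≟_ (suc v) (map length Cs)  ∎)
      where open ≡-Reasoning

-- Conjugate partitions and dominance

Descending : List ℕ → Set
Descending = Linked _≥_

descending-↭⇒≡ : ∀ {xs ys} → Descending xs → Descending ys → xs ↭ ys → xs ≡ ys
descending-↭⇒≡ xs↘ ys↘ xs↭ys =
  Pointwise-≡⇒≡ (↗↭↗⇒≋ (Flip.totalOrder ≤-totalOrder) xs↘ ys↘ (↭⇒↭ₛ′ isEquivalence xs↭ys))

descending-head-max : ∀ {x xs} → Descending (x ∷ xs) → All (_≤ x) (x ∷ xs)
descending-head-max = Linked⇒All (λ y≤x z≤y → ≤-trans z≤y y≤x) ≤-refl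

module SortDescendingBy {A : Set} (key : A → ℕ) where

  open import Data.List.Sort (On.decTotalOrder (Flip.decTotalOrder ≤-decTotalOrder) key)
    using (sort; sort-↭; sort-↗) public

  sort-descending : ∀ xs → Descending (map key (sort xs))
  sort-descending xs = Linked-map⁺ (sort-↗ xs)

take-applyUpTo : ∀ {A : Set} (f : ℕ → A) k m → take k (applyUpTo f m) ≡ applyUpTo f (k ⊓ m)
take-applyUpTo f zero m = refl
take-applyUpTo f (suc k) zero = refl
take-applyUpTo f (suc k) (suc m) = cong (f 0 ∷_) (take-applyUpTo (f ∘ suc) k m)

count-<ᵇ-upTo : ∀ m y → count (_<ᵇ y) (upTo m) ≡ y ⊓ m
count-<ᵇ-upTo zero y = sym (⊓-zeroʳ y)
count-<ᵇ-upTo (suc m) zero = count-none (_<ᵇ 0) (upTo (suc m)) λ _ → refl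
count-<ᵇ-upTo (suc m) (suc y) = cong suc (begin
  count (_<ᵇ suc y) (applyUpTo suc m)  ≡⟨ cong (count (_<ᵇ suc y)) (map-upTo suc m) ⟨
  count (_<ᵇ suc y) (map suc (upTo m)) ≡⟨ count-map (_<ᵇ suc y) suc (upTo m) ⟩
  count (_<ᵇ y) (upTo m)               ≡⟨ count-<ᵇ-upTo m y ⟩
  y ⊓ m                                ∎)
  where open ≡-Reasoning

clippedSum : ℕ → List ℕ → ℕ
clippedSum k = ∑ (_⊓ k)

conj-prefixSum : ∀ μ k → Descending μ → sum (take k (conj μ)) ≡ clippedSum k μ
conj-prefixSum [] zero _ = refl
conj-prefixSum [] (suc k) _ = refl
conj-prefixSum (x ∷ xs) k μ↘ = begin
  sum (take k (map columnHeight (upTo x)))                 ≡⟨ cong sum (take-map k (upTo x)) ⟩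
  ∑ columnHeight (take k (upTo x))                         ≡⟨ cong (∑ columnHeight) (take-applyUpTo id k x) ⟩
  ∑ columnHeight (upTo (k ⊓ x))                            ≡⟨ ∑-count-swap _<ᵇ_ (upTo (k ⊓ x)) (x ∷ xs) ⟩
  ∑ (λ y → count (_<ᵇ y) (upTo (k ⊓ x))) (x ∷ xs)          ≡⟨ ∑-cong (x ∷ xs) (λ {y} _ → count-<ᵇ-upTo (k ⊓ x) y) ⟩
  ∑ (λ y → y ⊓ (k ⊓ x)) (x ∷ xs)                          ≡⟨ ∑-cong (x ∷ xs) clip ⟩
  clippedSum k (x ∷ xs)                                    ∎
  where
  open ≡-Reasoning
  columnHeight : ℕ → ℕ
  columnHeight i = count (i <ᵇ_) (x ∷ xs)
  clip : ∀ {y} → y ∈ x ∷ xs → y ⊓ (k ⊓ x) ≡ y ⊓ k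
  clip y∈ = trans (cong (_ ⊓_) (⊓-comm k x))
                  (trans (sym (⊓-assoc _ x k)) (cong (_⊓ k) (m≤n⇒m⊓n≡m (All.lookup (descending-head-max μ↘) y∈))))

decrementFirst : ℕ → List ℕ → List ℕ
decrementFirst zero cs = cs
decrementFirst (suc m) [] = []
decrementFirst (suc m) (c ∷ cs) = pred c ∷ decrementFirst m cs

data PositivePrefix : ℕ → List ℕ → Set where
  []  : ∀ {cs} → PositivePrefix 0 cs
  _∷_ : ∀ {m c cs} → 0 < c → PositivePrefix m cs → PositivePrefix (suc m) (c ∷ cs)

infix 4 _≤conj_

-- μ ≤conj c is μ ≤Dom conj c for descending c (≤conj⇔≤Dom-conj), phrased through the clipped
-- sums Σ_j min(c_j, k), which need no sorting of c and are invariant under permuting it.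
_≤conj_ : List ℕ → List ℕ → Set
μ ≤conj cs = ∀ k → sum (take k μ) ≤ clippedSum k cs

≤conj-resp-↭ : ∀ {ν cs ds} → cs ↭ ds → ν ≤conj cs → ν ≤conj ds
≤conj-resp-↭ {ν} cs↭ds dom k = subst (sum (take k ν) ≤_) (∑-↭ (_⊓ k) cs↭ds) (dom k)

≤conj⇔≤Dom-conj : ∀ {ν μ} → Descending μ → ν ≤conj μ ⇔ ν ≤Dom conj μ
≤conj⇔≤Dom-conj {ν} {μ} μ↘ = mk⇔
  (λ dom k → subst (sum (take k ν) ≤_) (sym (conj-prefixSum μ k μ↘)) (dom k))
  (λ dom k → subst (sum (take k ν) ≤_) (conj-prefixSum μ k μ↘) (dom k))

clippedSum-suc-decrementFirst : ∀ {m xs} k → PositivePrefix m xs → All (_≤ k) xs →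
                                clippedSum (suc k) xs ≡ m + clippedSum k (decrementFirst m xs)
clippedSum-suc-decrementFirst {xs = xs} k [] xs≤k =
  ∑-cong xs λ x∈ → let x≤k = All.lookup xs≤k x∈ in trans (m≤n⇒m⊓n≡m (m≤n⇒m≤1+n x≤k)) (sym (m≤n⇒m⊓n≡m x≤k))
clippedSum-suc-decrementFirst {suc m} {suc c ∷ xs} k (_ ∷ p) (_ ∷ xs≤k) =
  cong suc (trans (cong (c ⊓ k +_) (clippedSum-suc-decrementFirst k p xs≤k)) (x∙yz≈y∙xz (c ⊓ k) m _))

-- Either the first m entries all exceed k, and clipping at k hides the decrement, or one of
-- them is at most k; then, cs being descending, so is every later entry.
clippedSum-decrementFirst : ∀ {m cs} k → Descending cs → PositivePrefix m cs →
                            clippedSum k (decrementFirst m cs) ≡ clippedSum k cs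
                          ⊎ clippedSum (suc k) cs ≡ m + clippedSum k (decrementFirst m cs)
clippedSum-decrementFirst k cs↘ [] = inj₁ refl
clippedSum-decrementFirst {suc m} {suc c ∷ cs} k cs↘ (c>0 ∷ p) with suc c ≤? k
... | yes c≤k = inj₂ (clippedSum-suc-decrementFirst k (c>0 ∷ p)
                        (All.map (λ x≤c → ≤-trans x≤c c≤k) (descending-head-max cs↘)))
... | no c≰k with ≤-pred (≰⇒> c≰k) | clippedSum-decrementFirst k (Linked.tail cs↘) p
...   | k≤c | inj₁ same = inj₁ (cong₂ _+_ (trans (m≥n⇒m⊓n≡n k≤c) (sym (m≥n⇒m⊓n≡n (m≤n⇒m≤1+n k≤c)))) same)
...   | k≤c | inj₂ shift = inj₂ (cong suc (begin
  c ⊓ k + clippedSum (suc k) cs                    ≡⟨ cong₂ _+_ (m≥n⇒m⊓n≡n k≤c) shift ⟩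
  k + (m + clippedSum k (decrementFirst m cs))     ≡⟨ x∙yz≈y∙xz k m _ ⟩
  m + (k + clippedSum k (decrementFirst m cs))     ≡⟨ cong (λ z → m + (z + _)) (m≥n⇒m⊓n≡n k≤c) ⟨
  m + (c ⊓ k + clippedSum k (decrementFirst m cs)) ∎))
  where open ≡-Reasoning

clippedSum-1-zeros : ∀ {cs} → Descending (0 ∷ cs) → clippedSum 1 cs ≡ 0
clippedSum-1-zeros {cs} cs↘ with descending-head-max cs↘
... | _ ∷ cs≤0 = trans (∑-cong cs λ x∈ → cong (_⊓ 1) (n≤0⇒n≡0 (All.lookup cs≤0 x∈)))
                     (trans (∑-const 0 cs) (*-zeroʳ (length cs)))

positivePrefix : ∀ {m cs} → Descending cs → m ≤ clippedSum 1 cs → PositivePrefix m cs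
positivePrefix {zero} cs↘ m≤ = []
positivePrefix {suc m} {zero ∷ cs} cs↘ m≤ = contradiction (subst (suc m ≤_) (clippedSum-1-zeros cs↘) m≤) λ ()
positivePrefix {suc m} {suc c ∷ cs} cs↘ m≤ =
  s≤s z≤n ∷ positivePrefix (Linked.tail cs↘) (≤-pred (subst (suc m ≤_) (cong (λ z → suc z + _) (⊓-zeroʳ c)) m≤))

prefixSum-tail≤ : ∀ {x xs} → Descending (x ∷ xs) → ∀ k → sum (take k xs) ≤ sum (take k (x ∷ xs))
prefixSum-tail≤ xs↘ zero = z≤n
prefixSum-tail≤ {xs = []} xs↘ (suc k) = z≤n
prefixSum-tail≤ {xs = y ∷ xs} (y≤x ∷ xs↘) (suc k) = +-mono-≤ y≤x (prefixSum-tail≤ xs↘ k)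

dominance-step : ∀ {m μ cs} → Descending (m ∷ μ) → Descending cs → m ∷ μ ≤conj cs →
                 PositivePrefix m cs × μ ≤conj decrementFirst m cs
dominance-step {m} {μ} {cs} μ↘ cs↘ dom = positive , dom′
  where
  positive : PositivePrefix m cs
  positive = positivePrefix cs↘ (subst (_≤ clippedSum 1 cs) (+-identityʳ m) (dom 1))
  dom′ : μ ≤conj decrementFirst m cs
  dom′ k with clippedSum-decrementFirst k cs↘ positive
  ... | inj₁ same = ≤-trans (prefixSum-tail≤ μ↘ k) (subst (sum (take k (m ∷ μ)) ≤_) (sym same) (dom k))
  ... | inj₂ shift = +-cancelˡ-≤ m _ _ (subst (sum (take (suc k) (m ∷ μ)) ≤_) shift (dom (suc k)))

-- Set partitions and their blocks

infix 4 _∼⟨_⟩_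

_∼⟨_⟩_ : ∀ {n} → Fin n → SetPart n → Fin n → Set
i ∼⟨ σ ⟩ j = rel σ i j ≡ true

rel-cong : ∀ {n} (σ : SetPart n) {i j} → i ∼⟨ σ ⟩ j → ∀ x → rel σ i x ≡ rel σ j x
rel-cong σ {i} {j} i∼j x = Bool-ext (transR σ j i x (symR σ i j i∼j)) (transR σ i j x i∼j)

TrivialMeet : ∀ {n} → SetPart n → SetPart n → Set
TrivialMeet σ τ = ∀ {i j} → i ∼⟨ σ ⟩ j → i ∼⟨ τ ⟩ j → i ≡ j

module _ {n : ℕ} (f : Fin n → ℕ) where

  private
    sameValue : Fin n → Fin n → Bool
    sameValue i j = f i ≡ᵇ f j

    sameValue⁺ : ∀ {i j} → f i ≡ f j → sameValue i j ≡ true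
    sameValue⁺ eq = T⇒≡true (≡⇒≡ᵇ _ _ eq)

    sameValue⁻ : ∀ {i j} → sameValue i j ≡ true → f i ≡ f j
    sameValue⁻ e = ≡ᵇ⇒≡ _ _ (≡true⇒T e)

  kernel : SetPart n
  kernel = record
    { rel    = sameValue
    ; reflR  = λ i → sameValue⁺ refl
    ; symR   = λ i j e → sameValue⁺ (sym (sameValue⁻ e))
    ; transR = λ i j k e e′ → sameValue⁺ (trans (sameValue⁻ e) (sameValue⁻ e′))
    }

  kernel-rel⁺ : ∀ {i j} → f i ≡ f j → i ∼⟨ kernel ⟩ j
  kernel-rel⁺ = sameValue⁺

  kernel-rel⁻ : ∀ {i j} → i ∼⟨ kernel ⟩ j → f i ≡ f j
  kernel-rel⁻ = sameValue⁻

module Blocks {n : ℕ} (σ : SetPart n) where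

  Leader : Fin n → Set
  Leader j = isLeast σ j ≡ true

  private
    earlierRelated : Fin n → Fin n → Bool
    earlierRelated j k = (toℕ k <ᵇ toℕ j) ∧ rel σ k j

  leader-minimal : ∀ {j k} → Leader j → k ∼⟨ σ ⟩ j → ¬ (k <ᶠ j)
  leader-minimal {j} {k} lj k∼j k<j = case trans (sym lj) (cong not (T⇒≡true found)) of λ ()
    where
    found : T (any (earlierRelated j) (allFin n))
    found = any⁺ (earlierRelated j) (Any.map (λ { refl → from T-∧ (<⇒<ᵇ k<j , ≡true⇒T k∼j) }) (∈-allFin k))

  nonLeader-earlier : ∀ j → ¬ Leader j → ∃[ k ] k <ᶠ j × k ∼⟨ σ ⟩ j
  nonLeader-earlier j ¬lj with any (earlierRelated j) (allFin n) in e
  ... | false = contradiction refl ¬lj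
  ... | true  with satisfied (any⁻ (earlierRelated j) (allFin n) (≡true⇒T e))
  ...   | k , k≺j = let k<j , k∼j = to T-∧ k≺j in k , <ᵇ⇒< _ _ k<j , T⇒≡true k∼j

  leader-exists : ∀ i → ∃[ j ] Leader j × j ∼⟨ σ ⟩ i
  leader-exists = WF.All.wfRec <-wellFounded-Fin _ (λ i → ∃[ j ] Leader j × j ∼⟨ σ ⟩ i) step
    where
    step : ∀ i → (∀ {k} → k <ᶠ i → ∃[ j ] Leader j × j ∼⟨ σ ⟩ k) → ∃[ j ] Leader j × j ∼⟨ σ ⟩ i
    step i rec with isLeast σ i in li
    ... | true  = i , li , reflR σ i
    ... | false with nonLeader-earlier i (λ e → case trans (sym li) e of λ ())
    ...   | k , k<i , k∼i = let j , lj , j∼k = rec k<i in j , lj , transR σ j k i j∼k k∼i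

  leader-unique : ∀ {j j′} → Leader j → Leader j′ → j ∼⟨ σ ⟩ j′ → j ≡ j′
  leader-unique {j} {j′} lj lj′ j∼j′ with Fin.<-cmp j j′
  ... | tri< j<j′ _ _ = contradiction j<j′ (leader-minimal lj′ j∼j′)
  ... | tri≈ _ j≡j′ _ = j≡j′
  ... | tri> _ _ j′<j = contradiction j′<j (leader-minimal lj (symR σ j j′ j∼j′))

  leaders : List (Fin n)
  leaders = filterᵇ (isLeast σ) (allFin n)

  ∈-leaders⁺ : ∀ {j} → Leader j → j ∈ leaders
  ∈-leaders⁺ {j} lj = ∈-filter⁺ (T? ∘ isLeast σ) (∈-allFin j) (≡true⇒T lj)

  ∈-leaders⁻ : ∀ {j} → j ∈ leaders → Leader j
  ∈-leaders⁻ j∈ = T⇒≡true (proj₂ (∈-filter⁻ (T? ∘ isLeast σ) {xs = allFin n} j∈))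

  oneLeaderPerClass : ∀ i → count (λ j → rel σ j i) leaders ≡ 1
  oneLeaderPerClass i =
    let j , lj , j∼i = leader-exists i in
    count≡1 (λ j → rel σ j i) (Unique.filter⁺ (T? ∘ isLeast σ) (Unique.allFin⁺ n)) (∈-leaders⁺ lj) j∼i
      λ k∈ k∼i → leader-unique (∈-leaders⁻ k∈) lj (transR σ _ i j k∼i (symR σ j i j∼i))

  class : Fin n → List (Fin n)
  class j = filterᵇ (rel σ j) (allFin n)

  ∈-class⁺ : ∀ {i j} → j ∼⟨ σ ⟩ i → i ∈ class j
  ∈-class⁺ {i} {j} j∼i = ∈-filter⁺ (T? ∘ rel σ j) (∈-allFin i) (≡true⇒T j∼i)

  ∈-class⁻ : ∀ {i j} → i ∈ class j → j ∼⟨ σ ⟩ i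
  ∈-class⁻ {i} {j} i∈ = T⇒≡true (proj₂ (∈-filter⁻ (T? ∘ rel σ j) {xs = allFin n} i∈))

  class-unique : ∀ j → Unique (class j)
  class-unique j = Unique.filter⁺ (T? ∘ rel σ j) (Unique.allFin⁺ n)

  blockSize≡length-class : ∀ {i j} → j ∼⟨ σ ⟩ i → blockSize σ i ≡ length (class j)
  blockSize≡length-class {i} {j} j∼i = count-cong (allFin n) λ {x} _ → rel-cong σ (symR σ j i j∼i) x

  blocks : List (List (Fin n))
  blocks = map class leaders

  concatMap-class-↭ : ∀ xs → concatMap (λ t → filterᵇ (rel σ t) xs) leaders ↭ xs
  concatMap-class-↭ xs = concatMap-filter-↭ (rel σ) leaders xs λ {i} _ → oneLeaderPerClass i

  blocks-↭ : concat blocks ↭ allFin n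
  blocks-↭ = concatMap-class-↭ (allFin n)

  length≡∑-count-classes : ∀ xs → length xs ≡ ∑ (λ t → count (rel σ t) xs) leaders
  length≡∑-count-classes xs = begin
    length xs                               ≡⟨ ↭-length (concatMap-class-↭ xs) ⟨
    length (concatMap pieceOf leaders)      ≡⟨ length-concat (map pieceOf leaders) ⟩
    ∑ length (map pieceOf leaders)          ≡⟨ cong sum (map-∘ leaders) ⟨
    ∑ (λ t → count (rel σ t) xs) leaders    ∎
    where
    open ≡-Reasoning
    pieceOf : Fin n → List (Fin n)
    pieceOf t = filterᵇ (rel σ t) xs

  blockSizes≡ : blockSizes σ ≡ map length blocks
  blockSizes≡ = map-∘ leaders

  blocks-sizedBy : SizedBy (blockSize σ) blocks
  blocks-sizedBy B∈ i∈B with ∈-map⁻ class B∈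
  ... | j , _ , refl = blockSize≡length-class (∈-class⁻ i∈B)

  blockSize>0 : ∀ i → 0 < blockSize σ i
  blockSize>0 i = count>0 (rel σ i) (allFin n) (∈-allFin i) (reflR σ i)

  blocks-nonEmpty : All (λ B → 0 < length B) blocks
  blocks-nonEmpty = All-map⁺ (All.tabulate λ {j} _ → blockSize>0 j)

  open SortDescendingBy {List (Fin n)} length using (sort; sort-↭; sort-descending)

  sortedBlocks : List (List (Fin n))
  sortedBlocks = sort blocks

  shape : List ℕ
  shape = map length sortedBlocks

  sortedBlocks-↭ : concat sortedBlocks ↭ allFin n
  sortedBlocks-↭ = ↭-trans (concat⁺ (sort-↭ blocks)) blocks-↭

  sortedBlock-class : ∀ {E} → E ∈ sortedBlocks → ∃[ j ] E ≡ class j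
  sortedBlock-class E∈ = let j , _ , E≡ = ∈-map⁻ class (∈-resp-↭ (sort-↭ blocks) E∈) in j , E≡

  shape-↭ : blockSizes σ ↭ shape
  shape-↭ = subst (_↭ shape) (sym blockSizes≡) (map⁺ length (↭-sym (sort-↭ blocks)))

  shape-isPart : IsPart n shape
  shape-isPart = sort-descending blocks , positive , total
    where
    positive : All (0 <_) shape
    positive = All-resp-↭ (map⁺ length (↭-sym (sort-↭ blocks))) (All-map⁺ blocks-nonEmpty)
    total : sum shape ≡ n
    total = begin
      ∑ length sortedBlocks       ≡⟨ length-concat sortedBlocks ⟨
      length (concat sortedBlocks) ≡⟨ ↭-length sortedBlocks-↭ ⟩
      length (allFin n)           ≡⟨ length-tabulate id ⟩
      n                           ∎
      where open ≡-Reasoning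

module _ {n : ℕ} where

  open import Data.List.Membership.DecPropositional (Fin._≟_ {n}) using (_∈?_)

  blockIndex : List (List (Fin n)) → Fin n → ℕ
  blockIndex [] i = 0
  blockIndex (B ∷ Bs) i = if does (i ∈? B) then 0 else suc (blockIndex Bs i)

  fromBlocks : List (List (Fin n)) → SetPart n
  fromBlocks Bs = kernel (blockIndex Bs)

  blockIndex-here : ∀ {B : List (Fin n)} Bs {i} → i ∈ B → blockIndex (B ∷ Bs) i ≡ 0
  blockIndex-here {B = B} Bs {i} i∈B rewrite dec-true (i ∈? B) i∈B = refl

  blockIndex-there : ∀ {B : List (Fin n)} Bs {i} → ¬ i ∈ B → blockIndex (B ∷ Bs) i ≡ suc (blockIndex Bs i)
  blockIndex-there {B = B} Bs {i} i∉B rewrite dec-false (i ∈? B) i∉B = refl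

  blockIndex-same : ∀ (Bs : List (List (Fin n))) {i j} → i ∈ concat Bs →
                    blockIndex Bs i ≡ blockIndex Bs j → ∃[ B ] B ∈ Bs × i ∈ B × j ∈ B
  blockIndex-same (B ∷ Bs) {i} {j} i∈ same = compare (i ∈? B) (j ∈? B)
    where
    compare : Dec (i ∈ B) → Dec (j ∈ B) → ∃[ C ] C ∈ B ∷ Bs × i ∈ C × j ∈ C
    compare (yes i∈B) (yes j∈B) = B , here refl , i∈B , j∈B
    compare (yes i∈B) (no j∉B)  =
      contradiction (trans (sym (blockIndex-here Bs i∈B)) (trans same (blockIndex-there Bs j∉B))) λ ()
    compare (no i∉B)  (yes j∈B) =
      contradiction (trans (sym (blockIndex-there Bs i∉B)) (trans same (blockIndex-here Bs j∈B))) λ ()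
    compare (no i∉B)  (no j∉B) with ∈-++⁻ B i∈
    ... | inj₁ i∈B  = contradiction i∈B i∉B
    ... | inj₂ i∈Bs =
      let C , C∈ , i∈C , j∈C = blockIndex-same Bs i∈Bs
            (suc-injective (trans (sym (blockIndex-there Bs i∉B)) (trans same (blockIndex-there Bs j∉B))))
      in C , there C∈ , i∈C , j∈C

  count-sameIndex : ∀ (Bs : List (List (Fin n))) {B i} → Unique (concat Bs) → B ∈ Bs → i ∈ B →
                    count (λ j → blockIndex Bs i ≡ᵇ blockIndex Bs j) (concat Bs) ≡ length B
  count-sameIndex (B ∷ Bs) {i = i} u (here refl) i∈B = begin
    count sameAsI (B ++ concat Bs)             ≡⟨ count-++ sameAsI B (concat Bs) ⟩
    count sameAsI B + count sameAsI (concat Bs)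
      ≡⟨ cong₂ _+_ (count-all sameAsI B λ j∈B → index≡ (blockIndex-here Bs j∈B))
                   (count-none sameAsI (concat Bs) λ j∈Bs → index≡ (outside j∈Bs)) ⟩
    length B + 0                               ≡⟨ +-identityʳ (length B) ⟩
    length B                                   ∎
    where
    open ≡-Reasoning
    sameAsI : Fin n → Bool
    sameAsI j = blockIndex (B ∷ Bs) i ≡ᵇ blockIndex (B ∷ Bs) j
    index≡ : ∀ {j v} → blockIndex (B ∷ Bs) j ≡ v → sameAsI j ≡ (0 ≡ᵇ v)
    index≡ = cong₂ _≡ᵇ_ (blockIndex-here Bs i∈B)
    outside : ∀ {j} → j ∈ concat Bs → blockIndex (B ∷ Bs) j ≡ suc (blockIndex Bs j)
    outside j∈Bs = blockIndex-there Bs λ j∈B → proj₂ (Unique-++⁻ B u) j∈B j∈Bs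
  count-sameIndex (B₀ ∷ Bs) {B} {i} u (there B∈) i∈B = begin
    count sameAsI (B₀ ++ concat Bs)              ≡⟨ count-++ sameAsI B₀ (concat Bs) ⟩
    count sameAsI B₀ + count sameAsI (concat Bs)
      ≡⟨ cong₂ _+_ (count-none sameAsI B₀ λ j∈B₀ → index≡ (blockIndex-here Bs j∈B₀))
                   (count-cong (concat Bs) λ j∈Bs → index≡ (outside j∈Bs)) ⟩
    0 + count (λ j → blockIndex Bs i ≡ᵇ blockIndex Bs j) (concat Bs)
                                                 ≡⟨ count-sameIndex Bs (proj₁ (Unique-++⁻ B₀ u)) B∈ i∈B ⟩
    length B                                     ∎
    where
    open ≡-Reasoning
    sameAsI : Fin n → Bool
    sameAsI j = blockIndex (B₀ ∷ Bs) i ≡ᵇ blockIndex (B₀ ∷ Bs) j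
    outside : ∀ {j} → j ∈ concat Bs → blockIndex (B₀ ∷ Bs) j ≡ suc (blockIndex Bs j)
    outside j∈Bs = blockIndex-there Bs λ j∈B₀ → proj₂ (Unique-++⁻ B₀ u) j∈B₀ j∈Bs
    index≡ : ∀ {j v} → blockIndex (B₀ ∷ Bs) j ≡ v → sameAsI j ≡ (suc (blockIndex Bs i) ≡ᵇ v)
    index≡ = cong₂ _≡ᵇ_ (outside (∈-concat⁺′ i∈B B∈))

module FromBlocks {n : ℕ} (Bs : List (List (Fin n))) (cover : concat Bs ↭ allFin n) where

  private
    τ : SetPart n
    τ = fromBlocks Bs

  fromBlocks-rel⁻ : ∀ {i j} → i ∼⟨ τ ⟩ j → ∃[ B ] B ∈ Bs × i ∈ B × j ∈ B
  fromBlocks-rel⁻ {i} i∼j =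
    blockIndex-same Bs (∈-resp-↭ (↭-sym cover) (∈-allFin i)) (kernel-rel⁻ (blockIndex Bs) i∼j)

  fromBlocks-sizedBy : SizedBy (blockSize τ) Bs
  fromBlocks-sizedBy {B} {i} B∈ i∈B =
    trans (count-↭ (rel τ i) (↭-sym cover))
          (count-sameIndex Bs (Unique-resp-↭ (↭-sym cover) (Unique.allFin⁺ n)) B∈ i∈B)

  fromBlocks-shape : All (λ B → 0 < length B) Bs → blockSizes τ ↭ map length Bs
  fromBlocks-shape nonEmpty = subst (_↭ map length Bs) (sym blockSizes≡)
    (lengths-↭ (blockSize τ) (↭-trans blocks-↭ (↭-sym cover))
               blocks-nonEmpty nonEmpty blocks-sizedBy fromBlocks-sizedBy)
    where open Blocks τ

-- Atoms of Π_n

module _ {n : ℕ} where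

  open PosetNotions (_≤Π_ {n}) (bottomΠ n) using (Atom; AtomsMeet)

  bottom-rel⁻ : ∀ {i j : Fin n} → i ∼⟨ bottomΠ n ⟩ j → i ≡ j
  bottom-rel⁻ {i} {j} i∼j with i Fin.≟ j
  ... | yes i≡j = i≡j

  bottom-least : ∀ σ → bottomΠ n ≤Π σ
  bottom-least σ i j i∼j with bottom-rel⁻ i∼j
  ... | refl = reflR σ i

  Share : SetPart n → SetPart n → Set
  Share σ τ = ∃[ i ] ∃[ j ] i ≢ j × i ∼⟨ σ ⟩ j × i ∼⟨ τ ⟩ j

  share? : ∀ σ τ → Dec (Share σ τ)
  share? σ τ = Fin.any? λ i → Fin.any? λ j →
    ¬? (i Fin.≟ j) ×-dec (rel σ i j Bool.≟ true) ×-dec (rel τ i j Bool.≟ true)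

  ¬share⇒trivialMeet : ∀ {σ τ} → ¬ Share σ τ → TrivialMeet σ τ
  ¬share⇒trivialMeet ¬share {i} {j} i∼j i≈j with i Fin.≟ j
  ... | yes i≡j = i≡j
  ... | no i≢j  = contradiction (i , j , i≢j , i∼j , i≈j) ¬share

  module PairAtom (i j : Fin n) (i≢j : i ≢ j) where

    InPair : Fin n → Set
    InPair u = u ≡ i ⊎ u ≡ j

    private
      label : Fin n → ℕ
      label u = if does ((u Fin.≟ i) ⊎-dec (u Fin.≟ j)) then 0 else suc (toℕ u)

      label-in : ∀ {u} → InPair u → label u ≡ 0
      label-in {u} p rewrite dec-true ((u Fin.≟ i) ⊎-dec (u Fin.≟ j)) p = refl

      label-out : ∀ {u} → ¬ InPair u → label u ≡ suc (toℕ u)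
      label-out {u} ¬p rewrite dec-false ((u Fin.≟ i) ⊎-dec (u Fin.≟ j)) ¬p = refl

    pairAtom : SetPart n
    pairAtom = kernel label

    pairAtom-rel⁻ : ∀ {u v} → u ∼⟨ pairAtom ⟩ v → u ≡ v ⊎ InPair u × InPair v
    pairAtom-rel⁻ {u} {v} u∼v with (u Fin.≟ i) ⊎-dec (u Fin.≟ j) | (v Fin.≟ i) ⊎-dec (v Fin.≟ j)
    ... | yes pu | yes pv = inj₂ (pu , pv)
    ... | yes pu | no ¬pv = contradiction (trans (sym (label-in pu)) (trans same (label-out ¬pv))) λ ()
      where same = kernel-rel⁻ label u∼v
    ... | no ¬pu | yes pv = contradiction (trans (sym (label-out ¬pu)) (trans same (label-in pv))) λ ()
      where same = kernel-rel⁻ label u∼v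
    ... | no ¬pu | no ¬pv =
      inj₁ (Fin.toℕ-injective (suc-injective (trans (sym (label-out ¬pu)) (trans same (label-out ¬pv)))))
      where same = kernel-rel⁻ label u∼v

    pairAtom-pair : i ∼⟨ pairAtom ⟩ j
    pairAtom-pair = kernel-rel⁺ label (trans (label-in (inj₁ refl)) (sym (label-in (inj₂ refl))))

    pairAtom-least : ∀ σ → i ∼⟨ σ ⟩ j → pairAtom ≤Π σ
    pairAtom-least σ i∼j u v u∼v with pairAtom-rel⁻ {u} {v} u∼v
    ... | inj₁ refl                 = reflR σ u
    ... | inj₂ (inj₁ refl , inj₁ refl) = reflR σ i
    ... | inj₂ (inj₁ refl , inj₂ refl) = i∼j
    ... | inj₂ (inj₂ refl , inj₁ refl) = symR σ i j i∼j
    ... | inj₂ (inj₂ refl , inj₂ refl) = reflR σ j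

    pairAtom-atom : Atom pairAtom
    pairAtom-atom = (λ (p≤0 , _) → i≢j (bottom-rel⁻ (p≤0 i j pairAtom-pair))) , below
      where
      below : ∀ σ → σ ≤Π pairAtom → (σ ≤Π bottomΠ n × bottomΠ n ≤Π σ) ⊎ (σ ≤Π pairAtom × pairAtom ≤Π σ)
      below σ σ≤p with rel σ i j in i∼j
      ... | true  = inj₂ (σ≤p , pairAtom-least σ i∼j)
      ... | false = inj₁ (σ≤0 , bottom-least σ)
        where
        σ≤0 : σ ≤Π bottomΠ n
        σ≤0 u v u∼v with pairAtom-rel⁻ {u} {v} (σ≤p u v u∼v)
        ... | inj₁ refl                 = reflR (bottomΠ n) u
        ... | inj₂ (inj₁ refl , inj₁ refl) = reflR (bottomΠ n) i
        ... | inj₂ (inj₂ refl , inj₂ refl) = reflR (bottomΠ n) j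
        ... | inj₂ (inj₁ refl , inj₂ refl) = contradiction (trans (sym u∼v) i∼j) λ ()
        ... | inj₂ (inj₂ refl , inj₁ refl) = contradiction (trans (sym (symR σ j i u∼v)) i∼j) λ ()

  share⇒atomsMeet : ∀ {σ τ} → Share σ τ → AtomsMeet σ τ
  share⇒atomsMeet {σ} {τ} (i , j , i≢j , i∼j , i≈j) =
    pairAtom , pairAtom-atom , pairAtom-least σ i∼j , pairAtom-least τ i≈j
    where open PairAtom i j i≢j

  atomsMeet⇒share : ∀ {σ τ} → AtomsMeet σ τ → Share σ τ
  atomsMeet⇒share {σ} {τ} (t , (t≉0 , _) , t≤σ , t≤τ) with share? t t
  ... | yes (i , j , i≢j , i∼j , _) = i , j , i≢j , t≤σ i j i∼j , t≤τ i j i∼j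
  ... | no ¬share = contradiction (t≤0 , bottom-least t) t≉0
    where
    t≤0 : t ≤Π bottomΠ n
    t≤0 u v u∼v with ¬share⇒trivialMeet {t} {t} ¬share {u} {v} u∼v u∼v
    ... | refl = reflR (bottomΠ n) u

-- Partitions meeting σ trivially

trivialMeet⇒shape-≤conj : ∀ {n} (σ τ : SetPart n) → TrivialMeet σ τ → Blocks.shape σ ≤conj blockSizes τ
trivialMeet⇒shape-≤conj {n} σ τ meet k = begin
  sum (take k shape)                              ≡⟨ cong sum (take-map k sortedBlocks) ⟩
  ∑ length firstBlocks                            ≡⟨ length-concat firstBlocks ⟨
  length (concat firstBlocks)                     ≡⟨ τ.length≡∑-count-classes (concat firstBlocks) ⟩
  ∑ (λ t → count (rel τ t) (concat firstBlocks)) τ.leaders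
                                      ≤⟨ ∑-mono τ.leaders (λ _ → ⊓-glb (fewerThanBlock _) (fewerThanK _)) ⟩
  ∑ (λ t → blockSize τ t ⊓ k) τ.leaders           ≡⟨ cong sum (map-∘ τ.leaders) ⟩
  clippedSum k (blockSizes τ)                     ∎
  where
  open Blocks σ
  module τ = Blocks τ
  open ≤-Reasoning

  firstBlocks : List (List (Fin n))
  firstBlocks = take k sortedBlocks

  fewerThanBlock : ∀ t → count (rel τ t) (concat firstBlocks) ≤ blockSize τ t
  fewerThanBlock t = ≤-trans (count-concat-take≤ (rel τ t) k sortedBlocks)
                             (≤-reflexive (count-↭ (rel τ t) sortedBlocks-↭))

  atMostOnePerBlock : ∀ t {E} → E ∈ firstBlocks → count (rel τ t) E ≤ 1
  atMostOnePerBlock t E∈ with sortedBlock-class (∈-take⁻ k sortedBlocks E∈)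
  ... | j , refl = count≤1 (rel τ t) (class-unique j) λ x∈ y∈ t∼x t∼y →
    meet (transR σ _ j _ (symR σ j _ (∈-class⁻ x∈)) (∈-class⁻ y∈)) (transR τ _ t _ (symR τ t _ t∼x) t∼y)

  fewerThanK : ∀ t → count (rel τ t) (concat firstBlocks) ≤ k
  fewerThanK t = begin
    count (rel τ t) (concat firstBlocks) ≡⟨ count-concat (rel τ t) firstBlocks ⟩
    ∑ (count (rel τ t)) firstBlocks      ≤⟨ ∑-mono firstBlocks (atMostOnePerBlock t) ⟩
    ∑ (λ _ → 1) firstBlocks              ≡⟨ ∑-const 1 firstBlocks ⟩
    length firstBlocks * 1               ≡⟨ *-identityʳ _ ⟩
    length firstBlocks                   ≡⟨ length-take k sortedBlocks ⟩
    k ⊓ length sortedBlocks              ≤⟨ m⊓n≤m k _ ⟩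
    k                                    ∎

module GreedyTransversal {n : ℕ} (σ : SetPart n) (μ : List ℕ) (μ-part : IsPart n μ) where

  open Blocks σ

  Transversal : List (Fin n) → Set
  Transversal B = ∀ {x y} → x ∈ B → y ∈ B → x ∼⟨ σ ⟩ y → x ≡ y

  Bin : Set
  Bin = ℕ × List (Fin n)

  capacity : Bin → ℕ
  capacity = proj₁

  contents : Bin → List (Fin n)
  contents = proj₂

  target : Bin → ℕ
  target (c , B) = c + length B

  distribute : List (Fin n) → List Bin → List Bin
  distribute [] bins = bins
  distribute (e ∷ E) [] = []
  distribute (e ∷ E) ((c , B) ∷ bins) = (pred c , e ∷ B) ∷ distribute E bins

  capacities-distribute : ∀ E bins →
                          map capacity (distribute E bins) ≡ decrementFirst (length E) (map capacity bins)
  capacities-distribute [] bins = refl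
  capacities-distribute (e ∷ E) [] = refl
  capacities-distribute (e ∷ E) ((c , B) ∷ bins) = cong (pred c ∷_) (capacities-distribute E bins)

  contents-distribute : ∀ E bins → PositivePrefix (length E) (map capacity bins) →
                        concat (map contents (distribute E bins)) ↭ E ++ concat (map contents bins)
  contents-distribute [] bins _ = ↭-refl
  contents-distribute (e ∷ E) ((c , B) ∷ bins) (_ ∷ p) =
    ↭-prep e (↭-trans (++⁺ˡ B (contents-distribute E bins p)) (shifts B E))

  targets-distribute : ∀ E bins → PositivePrefix (length E) (map capacity bins) →
                       map target (distribute E bins) ≡ map target bins
  targets-distribute [] bins _ = refl
  targets-distribute (e ∷ E) ((suc c , B) ∷ bins) (_ ∷ p) =
    cong₂ _∷_ (+-suc c (length B)) (targets-distribute E bins p)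

  transversal-∷ : ∀ {e B} → Transversal B → (∀ {b} → b ∈ B → ¬ e ∼⟨ σ ⟩ b) → Transversal (e ∷ B)
  transversal-∷ tB e≁B (here refl) (here refl) _   = refl
  transversal-∷ tB e≁B (here refl) (there y∈) e∼y = contradiction e∼y (e≁B y∈)
  transversal-∷ tB e≁B (there x∈) (here refl) x∼e = contradiction (symR σ _ _ x∼e) (e≁B x∈)
  transversal-∷ tB e≁B (there x∈) (there y∈) x∼y = tB x∈ y∈ x∼y

  transversal-distribute : ∀ E bins → All (Transversal ∘ contents) bins →
                           (∀ {e b} → e ∈ E → b ∈ concat (map contents bins) → ¬ e ∼⟨ σ ⟩ b) →
                           All (Transversal ∘ contents) (distribute E bins)
  transversal-distribute [] bins tbins apart = tbins
  transversal-distribute (e ∷ E) [] tbins apart = []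
  transversal-distribute (e ∷ E) ((c , B) ∷ bins) (tB ∷ tbins) apart =
    transversal-∷ tB (λ b∈ → apart (here refl) (∈-++⁺ˡ b∈))
    ∷ transversal-distribute E bins tbins (λ e∈ b∈ → apart (there e∈) (∈-++⁺ʳ B b∈))

  open SortDescendingBy capacity using (sort; sort-↭; sort-descending)

  -- Gale–Ryser: the pending blocks of σ are dealt out largest first, one element into each of
  -- the bins of largest remaining capacity; domination by the capacities is what makes enough
  -- of them positive (dominance-step).
  record Invariant (pending : List (List (Fin n))) (bins : List Bin) : Set where
    field
      pending-descending : Descending (map length pending)
      pending-classes    : ∀ {E} → E ∈ pending → ∃[ j ] E ≡ class j
      bins-descending    : Descending (map capacity bins)
      dominated          : map length pending ≤conj map capacity bins
      covering           : concat (map contents bins) ++ concat pending ↭ allFin n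
      targets            : map target bins ↭ μ
      transversal        : All (Transversal ∘ contents) bins

  step : ∀ E pending bins → Invariant (E ∷ pending) bins → Invariant pending (sort (distribute E bins))
  step E pending bins I = record
    { pending-descending = Linked.tail pending-descending
    ; pending-classes    = pending-classes ∘ there
    ; bins-descending    = sort-descending (distribute E bins)
    ; dominated          = ≤conj-resp-↭ (↭-sym capacities′) dominated′
    ; covering           = ↭-trans (++⁺ʳ (concat pending) contents′) (↭-trans shuffle covering)
    ; targets            = ↭-trans (map⁺ target (sort-↭ (distribute E bins)))
                                   (subst (_↭ μ) (sym (targets-distribute E bins positive)) targets)
    ; transversal        = All-resp-↭ (↭-sym (sort-↭ (distribute E bins)))
                                      (transversal-distribute E bins transversal apart)
    }
    where
    open Invariant I
    C : List (Fin n)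
    C = concat (map contents bins)

    positive : PositivePrefix (length E) (map capacity bins)
    positive = proj₁ (dominance-step pending-descending bins-descending dominated)

    dominated′ : map length pending ≤conj decrementFirst (length E) (map capacity bins)
    dominated′ = proj₂ (dominance-step pending-descending bins-descending dominated)

    capacities′ : map capacity (sort (distribute E bins)) ↭ decrementFirst (length E) (map capacity bins)
    capacities′ = ↭-trans (map⁺ capacity (sort-↭ (distribute E bins)))
                          (↭-reflexive (capacities-distribute E bins))

    contents′ : concat (map contents (sort (distribute E bins))) ↭ E ++ C
    contents′ = ↭-trans (concat⁺ (map⁺ contents (sort-↭ (distribute E bins))))
                        (contents-distribute E bins positive)

    shuffle : (E ++ C) ++ concat pending ↭ C ++ E ++ concat pending
    shuffle = ↭-trans (↭-reflexive (++-assoc E C (concat pending))) (shifts E C)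

    apart : ∀ {e b} → e ∈ E → b ∈ C → ¬ e ∼⟨ σ ⟩ b
    apart e∈E b∈C e∼b with pending-classes (here refl)
    ... | j , refl = proj₂ (Unique-++⁻ C (Unique-resp-↭ (↭-sym covering) (Unique.allFin⁺ n)))
                       b∈C (∈-++⁺ˡ (∈-class⁺ (transR σ j _ _ (∈-class⁻ e∈E) e∼b)))

  emptyBins : List Bin
  emptyBins = map (_, []) μ

  emptyBins-capacities : map capacity emptyBins ≡ μ
  emptyBins-capacities = trans (sym (map-∘ μ)) (map-id μ)

  initial : shape ≤conj μ → Invariant sortedBlocks emptyBins
  initial dom = record
    { pending-descending = proj₁ shape-isPart
    ; pending-classes    = sortedBlock-class
    ; bins-descending    = subst Descending (sym emptyBins-capacities) (proj₁ μ-part)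
    ; dominated          = subst (shape ≤conj_) (sym emptyBins-capacities) dom
    ; covering           = subst (λ C → C ++ concat sortedBlocks ↭ allFin n) (sym (noContents μ)) sortedBlocks-↭
    ; targets            = ↭-reflexive (trans (sym (map-∘ μ)) (trans (map-cong +-identityʳ μ) (map-id μ)))
    ; transversal        = All-map⁺ (All.tabulate λ _ → λ ())
    }
    where
    noContents : ∀ cs → concat (map contents (map (_, []) cs)) ≡ []
    noContents [] = refl
    noContents (c ∷ cs) = noContents cs

  run : ∀ pending bins → Invariant pending bins → ∃[ bins′ ] Invariant [] bins′
  run [] bins I = bins , I
  run (E ∷ pending) bins I = run pending (sort (distribute E bins)) (step E pending bins I)

  final-cover : ∀ {bins} → Invariant [] bins → concat (map contents bins) ↭ allFin n
  final-cover I = subst (_↭ allFin n) (++-identityʳ _) (Invariant.covering I)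

  final-capacities : ∀ {bins} → Invariant [] bins → ∀ {b} → b ∈ bins → capacity b ≡ 0
  final-capacities {bins} I = ∑≡0 bins (+-cancelʳ-≡ n (∑ capacity bins) 0 (begin
    ∑ capacity bins + n                          ≡⟨ cong (∑ capacity bins +_) contents-length ⟨
    ∑ capacity bins + ∑ (length ∘ contents) bins ≡⟨ ∑-+ capacity (length ∘ contents) bins ⟨
    ∑ target bins                                ≡⟨ sum-↭ (Invariant.targets I) ⟩
    sum μ                                        ≡⟨ proj₂ (proj₂ μ-part) ⟩
    n                                            ∎))
    where
    open ≡-Reasoning
    contents-length : ∑ (length ∘ contents) bins ≡ n
    contents-length = begin
      ∑ (length ∘ contents) bins          ≡⟨ cong sum (map-∘ bins) ⟩
      ∑ length (map contents bins)        ≡⟨ length-concat (map contents bins) ⟨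
      length (concat (map contents bins)) ≡⟨ ↭-length (final-cover I) ⟩
      length (allFin n)                   ≡⟨ length-tabulate id ⟩
      n                                   ∎

  transversalPartition : shape ≤conj μ → ∃[ τ ] blockSizes τ ↭ μ × TrivialMeet σ τ
  transversalPartition dom with run sortedBlocks emptyBins (initial dom)
  ... | bins , I = fromBlocks Bs , ↭-trans (fromBlocks-shape nonEmpty) lengths , meet
    where
    open Invariant I
    Bs : List (List (Fin n))
    Bs = map contents bins
    open FromBlocks Bs (final-cover I)
    lengths : map length Bs ↭ μ
    lengths = subst (_↭ μ) (trans (map-cong-local (All.tabulate λ b∈ → cong (_+ _) (final-capacities I b∈)))
                                  (map-∘ bins))
                    targets
    nonEmpty : All (λ B → 0 < length B) Bs
    nonEmpty = All-map⁻ (All-resp-↭ (↭-sym lengths) (proj₁ (proj₂ μ-part)))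
    meet : TrivialMeet σ (fromBlocks Bs)
    meet i∼j i≈j with fromBlocks-rel⁻ i≈j
    ... | B , B∈ , i∈B , j∈B = All.lookup (All-map⁺ transversal) B∈ i∈B j∈B i∼j

-- Refinement

≤Ref-resp-↭ : ∀ {μ μ′ ν ν′} → μ ↭ μ′ → ν ↭ ν′ → μ ≤Ref ν → μ′ ≤Ref ν′
≤Ref-resp-↭ μ↭μ′ ν↭ν′ (ls , sums , positive , ls↭μ) with Pointwise-↭ sums ν↭ν′
... | ls′ , sums′ , ls↭ls′ =
  ls′ , sums′ , All-resp-↭ ls↭ls′ positive , ↭-trans (concat⁺ (↭-sym ls↭ls′)) (↭-trans ls↭μ μ↭μ′)

≤Π⇒blockSizes-≤Ref : ∀ {n} {y σ : SetPart n} → y ≤Π σ → blockSizes y ≤Ref blockSizes σ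
≤Π⇒blockSizes-≤Ref {n} {y} {σ} y≤σ = parts , sums , positive , pieces
  where
  module Y = Blocks y
  module S = Blocks σ

  leadersWithin : Fin n → List (Fin n)
  leadersWithin j = filterᵇ (rel σ j) Y.leaders

  parts : List (List ℕ)
  parts = map (map (blockSize y) ∘ leadersWithin) S.leaders

  yClassWithin : ∀ {j t} → t ∈ leadersWithin j → count (rel y t) (S.class j) ≡ blockSize y t
  yClassWithin {j} {t} t∈ =
    count-filter-⊆ (rel σ j) (rel y t) (allFin n) λ _ t∼x → transR σ j t _ j∼t (y≤σ t _ t∼x)
    where
    j∼t : j ∼⟨ σ ⟩ t
    j∼t = T⇒≡true (proj₂ (∈-filter⁻ (T? ∘ rel σ j) {xs = Y.leaders} t∈))

  oneLeaderWithin : ∀ {j x} → x ∈ S.class j → count (λ t → rel y t x) (leadersWithin j) ≡ 1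
  oneLeaderWithin {j} {x} x∈ = trans
    (count-filter-⊆ (rel σ j) (λ t → rel y t x) Y.leaders
      λ _ t∼x → transR σ j x _ (S.∈-class⁻ x∈) (symR σ _ x (y≤σ _ x t∼x)))
    (Y.oneLeaderPerClass x)

  inner : ∀ j → ∑ (blockSize y) (leadersWithin j) ≡ blockSize σ j
  inner j = begin
    ∑ (blockSize y) (leadersWithin j)                         ≡⟨ ∑-cong (leadersWithin j) yClassWithin ⟨
    ∑ (λ t → count (rel y t) (S.class j)) (leadersWithin j)    ≡⟨ cong sum (map-∘ (leadersWithin j)) ⟩
    ∑ length (map pieceOf (leadersWithin j))                  ≡⟨ length-concat (map pieceOf (leadersWithin j)) ⟨
    length (concatMap pieceOf (leadersWithin j))
      ≡⟨ ↭-length (concatMap-filter-↭ (rel y) (leadersWithin j) (S.class j) oneLeaderWithin) ⟩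
    length (S.class j)                                        ∎
    where
    open ≡-Reasoning
    pieceOf : Fin n → List (Fin n)
    pieceOf t = filterᵇ (rel y t) (S.class j)

  sums : Pointwise (λ p l → sum l ≡ p) (blockSizes σ) parts
  sums = Pointwise-map (blockSize σ) (map (blockSize y) ∘ leadersWithin) S.leaders
           λ {j} _ → inner j

  positive : All (All (0 <_)) parts
  positive = All-map⁺ (All.tabulate λ _ → All-map⁺ (All.tabulate λ {t} _ → Y.blockSize>0 t))

  pieces : concat parts ↭ blockSizes y
  pieces = subst (_↭ blockSizes y)
    (trans (sym (concat-map (map leadersWithin S.leaders))) (cong concat (sym (map-∘ S.leaders))))
    (map⁺ (blockSize y) (concatMap-filter-↭ (rel σ) S.leaders Y.leaders λ {t} _ → S.oneLeaderPerClass t))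

module _ {A : Set} where

  splitInto : List A → List ℕ → List (List A)
  splitInto B [] = []
  splitInto B (a ∷ l) = take a B ∷ splitInto (drop a B) l

  private
    sum-drop : ∀ a l (B : List A) → a + sum l ≡ length B → sum l ≡ length (drop a B)
    sum-drop a l B eq = trans (sym (m+n∸m≡n a (sum l))) (trans (cong (_∸ a) eq) (sym (length-drop a B)))

  concat-splitInto : ∀ (B : List A) l → sum l ≡ length B → concat (splitInto B l) ≡ B
  concat-splitInto [] [] eq = refl
  concat-splitInto (x ∷ B) [] ()
  concat-splitInto B (a ∷ l) eq =
    trans (cong (take a B ++_) (concat-splitInto (drop a B) l (sum-drop a l B eq))) (take++drop≡id a B)

  lengths-splitInto : ∀ (B : List A) l → sum l ≡ length B → map length (splitInto B l) ≡ l
  lengths-splitInto B [] eq = refl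
  lengths-splitInto B (a ∷ l) eq =
    cong₂ _∷_ (trans (length-take a B) (m≤n⇒m⊓n≡m (subst (a ≤_) eq (m≤m+n a (sum l)))))
              (lengths-splitInto (drop a B) l (sum-drop a l B eq))

  splitInto-⊆ : ∀ (B : List A) l {C x} → C ∈ splitInto B l → x ∈ C → x ∈ B
  splitInto-⊆ B (a ∷ l) (here refl) x∈ = ∈-take⁻ a B x∈
  splitInto-⊆ B (a ∷ l) (there C∈) x∈ = ∈-drop⁻ a B (splitInto-⊆ (drop a B) l C∈ x∈)

  splitAll : List (List A) → List (List ℕ) → List (List A)
  splitAll (B ∷ Bs) (l ∷ ls) = splitInto B l ++ splitAll Bs ls
  splitAll _ _ = []

  SplitSizes : List (List A) → List (List ℕ) → Set
  SplitSizes Bs ls = Pointwise (λ p l → sum l ≡ p) (map length Bs) ls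

  concat-splitAll : ∀ Bs ls → SplitSizes Bs ls → concat (splitAll Bs ls) ≡ concat Bs
  concat-splitAll [] [] [] = refl
  concat-splitAll (B ∷ Bs) (l ∷ ls) (eq ∷ eqs) =
    trans (sym (concat-++ (splitInto B l) (splitAll Bs ls)))
          (cong₂ _++_ (concat-splitInto B l eq) (concat-splitAll Bs ls eqs))

  lengths-splitAll : ∀ Bs ls → SplitSizes Bs ls → map length (splitAll Bs ls) ≡ concat ls
  lengths-splitAll [] [] [] = refl
  lengths-splitAll (B ∷ Bs) (l ∷ ls) (eq ∷ eqs) =
    trans (map-++ length (splitInto B l) (splitAll Bs ls))
          (cong₂ _++_ (lengths-splitInto B l eq) (lengths-splitAll Bs ls eqs))

  splitAll-⊆ : ∀ Bs ls {C} → C ∈ splitAll Bs ls → ∃[ B ] B ∈ Bs × (∀ {x} → x ∈ C → x ∈ B)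
  splitAll-⊆ (B ∷ Bs) (l ∷ ls) C∈ with ∈-++⁻ (splitInto B l) C∈
  ... | inj₁ C∈B = B , here refl , splitInto-⊆ B l C∈B
  ... | inj₂ C∈Bs = let B′ , B′∈ , C⊆B′ = splitAll-⊆ Bs ls C∈Bs in B′ , there B′∈ , C⊆B′

≤Ref-blockSizes⇒≤Π : ∀ {n} (σ : SetPart n) {ν} → ν ≤Ref blockSizes σ → ∃[ y ] y ≤Π σ × blockSizes y ↭ ν
≤Ref-blockSizes⇒≤Π {n} σ {ν} (ls , sums , positive , ls↭ν) = fromBlocks Cs , y≤σ , shape-ν
  where
  open Blocks σ
  sizes : SplitSizes blocks ls
  sizes = subst (λ ps → Pointwise (λ p l → sum l ≡ p) ps ls) blockSizes≡ sums

  Cs : List (List (Fin n))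
  Cs = splitAll blocks ls

  cover : concat Cs ↭ allFin n
  cover = subst (_↭ allFin n) (sym (concat-splitAll blocks ls sizes)) blocks-↭

  open FromBlocks Cs cover

  y≤σ : fromBlocks Cs ≤Π σ
  y≤σ i j i∼j with fromBlocks-rel⁻ i∼j
  ... | C , C∈ , i∈C , j∈C with splitAll-⊆ blocks ls C∈
  ...   | B , B∈ , C⊆B with ∈-map⁻ class B∈
  ...     | l , _ , refl = transR σ i l j (symR σ l i (∈-class⁻ (C⊆B i∈C))) (∈-class⁻ (C⊆B j∈C))

  lengths : map length Cs ≡ concat ls
  lengths = lengths-splitAll blocks ls sizes

  shape-ν : blockSizes (fromBlocks Cs) ↭ ν
  shape-ν = ↭-trans (fromBlocks-shape nonEmpty) (subst (_↭ ν) (sym lengths) ls↭ν)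
    where
    nonEmpty : All (λ C → 0 < length C) Cs
    nonEmpty = All-map⁻ (subst (All (0 <_)) (sym lengths) (All-concat⁺ positive))

∑-blockSize≡∑-square : ∀ {n} (σ : SetPart n) → ∑ (blockSize σ) (allFin n) ≡ ∑ (λ s → s * s) (blockSizes σ)
∑-blockSize≡∑-square {n} σ = begin
  ∑ (blockSize σ) (allFin n)                    ≡⟨ ∑-↭ (blockSize σ) (↭-sym blocks-↭) ⟩
  ∑ (blockSize σ) (concat blocks)               ≡⟨ ∑-concat (blockSize σ) blocks ⟩
  ∑ (∑ (blockSize σ)) blocks                    ≡⟨ ∑-cong blocks constantOnBlock ⟩
  ∑ (λ B → length B * length B) blocks          ≡⟨ cong sum (map-∘ blocks) ⟩
  ∑ (λ s → s * s) (map length blocks)           ≡⟨ cong (∑ (λ s → s * s)) blockSizes≡ ⟨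
  ∑ (λ s → s * s) (blockSizes σ)                ∎
  where
  open Blocks σ
  open ≡-Reasoning
  constantOnBlock : ∀ {B} → B ∈ blocks → ∑ (blockSize σ) B ≡ length B * length B
  constantOnBlock {B} B∈ = trans (∑-cong B (blocks-sizedBy B∈)) (∑-const (length B) B)

-- blockSize y ≤ blockSize σ pointwise, and ∑-blockSize≡∑-square makes the totals equal,
-- so every block of y is a whole block of σ.
≤Π-sameSizes⇒≥Π : ∀ {n} {y σ : SetPart n} → y ≤Π σ → blockSizes y ↭ blockSizes σ → σ ≤Π y
≤Π-sameSizes⇒≥Π {n} {y} {σ} y≤σ sizes i j i∼j =
  count-mono-≡ (allFin n) (λ _ → y≤σ i _) (sameSize (∈-allFin i)) (∈-allFin j) i∼j
  where
  sameSize : ∀ {i} → i ∈ allFin n → blockSize y i ≡ blockSize σ i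
  sameSize = ∑-mono-≡ (allFin n) (λ {i} _ → count-mono (allFin n) λ _ → y≤σ i _)
    (trans (∑-blockSize≡∑-square y) (trans (∑-↭ (λ s → s * s) sizes) (sym (∑-blockSize≡∑-square σ))))

≤Π-antisym⇒blockSizes≡ : ∀ {n} {y σ : SetPart n} → y ≤Π σ → σ ≤Π y → blockSizes y ≡ blockSizes σ
≤Π-antisym⇒blockSizes≡ {n} {y} {σ} y≤σ σ≤y =
  trans (cong (map (blockSize y)) sameLeaders)
        (map-cong (λ i → count-cong (allFin n) λ _ → sameRel i _) (filterᵇ (isLeast σ) (allFin n)))
  where
  sameRel : ∀ i j → rel y i j ≡ rel σ i j
  sameRel i j = Bool-ext (y≤σ i j) (σ≤y i j)
  sameLeast : ∀ j → isLeast y j ≡ isLeast σ j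
  sameLeast j = cong (not ∘ or) (map-cong (λ i → cong ((toℕ i <ᵇ toℕ j) ∧_) (sameRel i j)) (allFin n))
  sameLeaders : filterᵇ (isLeast y) (allFin n) ≡ filterᵇ (isLeast σ) (allFin n)
  sameLeaders = filter-≐ (T? ∘ isLeast y) (T? ∘ isLeast σ)
    ((λ {j} → subst T (sameLeast j)) , (λ {j} → subst T (sym (sameLeast j)))) (allFin n)

-- The blocker

shape-unique : ∀ {n} (σ : SetPart n) {μ} → IsPart n μ → blockSizes σ ↭ μ → μ ≡ Blocks.shape σ
shape-unique σ (μ↘ , _) sizes =
  descending-↭⇒≡ μ↘ (proj₁ (Blocks.shape-isPart σ)) (↭-trans (↭-sym sizes) (Blocks.shape-↭ σ))

module Blocker {n : ℕ} (A : List (List ℕ)) (A-parts : All (IsPart n) A) where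

  open PosetNotions (_≤Π_ {n}) (bottomΠ n) using (Hits; InBlocker)
  open Blocks using (shape; shape-↭; shape-isPart)

  FiA : SetPart n → Set
  FiA = Fi n (_∈ A)

  member-isPart : ∀ {μ} → μ ∈ A → IsPart n μ
  member-isPart = All.lookup A-parts

  hits⇒notDominated : ∀ (σ : SetPart n) → Hits FiA σ → NotDominated A (shape σ)
  hits⇒notDominated σ hits μ μ∈A dom
    with GreedyTransversal.transversalPartition σ μ (member-isPart μ∈A)
           (from (≤conj⇔≤Dom-conj (proj₁ (member-isPart μ∈A))) dom)
  ... | τ , τ-shape , meet with atomsMeet⇒share {σ = σ} {τ} (hits τ (μ , μ∈A , τ-shape))
  ...   | i , j , i≢j , i∼j , i≈j = i≢j (meet i∼j i≈j)

  notDominated⇒hits : ∀ (σ : SetPart n) → NotDominated A (shape σ) → Hits FiA σ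
  notDominated⇒hits σ free τ (μ , μ∈A , τ-shape) with share? σ τ
  ... | yes share = share⇒atomsMeet {σ = σ} {τ} share
  ... | no ¬share = contradiction (to (≤conj⇔≤Dom-conj (proj₁ (member-isPart μ∈A)))
    (≤conj-resp-↭ τ-shape (trivialMeet⇒shape-≤conj σ τ (¬share⇒trivialMeet {σ = σ} {τ} ¬share)))) (free μ μ∈A)

  inBlocker⇒inB : ∀ (σ : SetPart n) → InBlocker FiA σ → InB n A (shape σ)
  inBlocker⇒inB σ (hits , minimal) = shape-isPart σ , hits⇒notDominated σ hits , shapeMinimal
    where
    shapeMinimal : ∀ ν → IsPart n ν → NotDominated A ν → ν ≤Ref shape σ → ν ≡ shape σ
    shapeMinimal ν ν-part ν-free ν≤σ
      with ≤Ref-blockSizes⇒≤Π σ (≤Ref-resp-↭ ↭-refl (↭-sym (shape-↭ σ)) ν≤σ)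
    ... | y , y≤σ , y-sizes =
      shape-unique σ ν-part (subst (_↭ ν) (≤Π-antisym⇒blockSizes≡ {y = y} {σ} y≤σ σ≤y) y-sizes)
      where
      σ≤y : σ ≤Π y
      σ≤y = minimal y (notDominated⇒hits y (subst (NotDominated A) (shape-unique y ν-part y-sizes) ν-free)) y≤σ

  inB⇒inBlocker : ∀ (σ : SetPart n) → InB n A (shape σ) → InBlocker FiA σ
  inB⇒inBlocker σ (_ , free , shapeMinimal) = notDominated⇒hits σ free , minimal
    where
    minimal : ∀ y → Hits FiA y → y ≤Π σ → σ ≤Π y
    minimal y hits y≤σ = ≤Π-sameSizes⇒≥Π {y = y} {σ} y≤σ
      (↭-trans (shape-↭ y) (subst (_↭ blockSizes σ) (sym sameShape) (↭-sym (shape-↭ σ))))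
      where
      sameShape : shape y ≡ shape σ
      sameShape = shapeMinimal (shape y) (shape-isPart y) (hits⇒notDominated y hits)
                    (≤Ref-resp-↭ (shape-↭ y) (shape-↭ σ) (≤Π⇒blockSizes-≤Ref {y = y} {σ} y≤σ))

theorem3p1 : (n : ℕ) (A : List (List ℕ)) → IsAntichainRef n A →
    (σ : SetPart n) → InBlockerΠ n (Fi n (λ μ → μ ∈ A)) σ ⇔ Fi n (InB n A) σ
theorem3p1 n A (_ , _ , A-parts , _) σ = mk⇔
  (λ inBlocker → shape σ , inBlocker⇒inB σ inBlocker , shape-↭ σ)
  (λ (μ , μ∈B , sizes) → inB⇒inBlocker σ (subst (InB n A) (shape-unique σ (proj₁ μ∈B) sizes) μ∈B))
  where
  open Blocker A A-parts
  open Blocks using (shape; shape-↭)
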